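{- Let $n\geq0$, $\mathbf{k}$ a commutative ring, $\mathcal{A}=\mathbf{k}[S_n]$, $D\subseteq[n]$, and let $\alpha=(\alpha_C)$ be a family of scalars in $\mathbf{k}$ indexed by the $|D|$-element subsets $C$ of $[n]$. Then $\left(\prod_{k=0}^{|D|}(\nabla_{D,\alpha}-\delta_{D,\alpha,k})\right)\nabla_{D,\alpha}=0$.
   Context: $[n]=\{1,\dots,n\}$. For $X,Y\subseteq[n]$: $\nabla_{Y,X}:=\sum_{w\in S_n,\ w(X)=Y}w\in\mathcal{A}$. $\omega_{B,C}:=|B\cap C|!\cdot|B\setminus C|!\cdot|C\setminus B|!\cdot|[n]\setminus(B\cup C)|!$. For $C\subseteq[n]$, $k\in\mathbb{N}$: $\delta_{D,C,k}:=\sum_{B\subseteq D,\ |B|=k}\omega_{B,C}(-1)^{k-|B\cap C|}\binom{k}{|B\cap C|}$. $\nabla_{D,\alpha}:=\sum_{C\subseteq[n],\ |C|=|D|}\alpha_C\nabla_{D,C}$ and $\delta_{D,\alpha,k}:=\sum_{C\subseteq[n],\ |C|=|D|}\alpha_C\delta_{D,C,k}\in\mathbf{k}$; scalars are identified with scalar multiples of $1_{\mathcal{A}}$. -}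

module Defs where

open import Level using (Level)
open import Algebra.Bundles using (CommutativeRing)
open import Data.Bool using (Bool; true; false; if_then_else_)
import Data.Bool as Bool
open import Data.Nat as ℕ using (ℕ; zero; suc; _∸_)
import Data.Nat.Properties as ℕP
open import Data.Nat.Combinatorics using (_C_)
open import Data.Nat using (_!)
open import Data.Fin using (Fin; zero; suc)
import Data.Fin.Properties as FinP
open import Data.Fin.Subset using (Subset; inside; outside; _∩_; _∪_; _─_; ∁; ∣_∣)
open import Data.Fin.Subset.Properties using (_⊆?_)
open import Data.Fin.Permutation using (Permutation′; id; insert; _⟨$⟩ʳ_; _⟨$⟩ˡ_; _∘ₚ_; flip)
open import Data.Vec using (Vec; []; _∷_; tabulate; lookup)
import Data.Vec.Properties as VecP
open import Data.List using (List; []; _∷_; map; foldr; concatMap; allFin; upTo; filter; _++_)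
open import Relation.Nullary using (does)
open import Relation.Binary.PropositionalEquality using (_≡_)

Perm : ℕ → Set
Perm n = Permutation′ n

-- Composition in the usual (right-to-left) convention: (u · v)(i) = u (v i).
_·ₚ_ : ∀ {n} → Perm n → Perm n → Perm n
u ·ₚ v = v ∘ₚ u

-- Complete, duplicate-free enumeration of S_n:
-- a permutation of Fin (suc n) is determined by the image i of 0 and a
-- permutation of the remaining n points (stdlib 'insert zero i π').
allPerms : (n : ℕ) → List (Perm n)
allPerms zero    = id ∷ []
allPerms (suc n) = concatMap (λ i → map (insert zero i) (allPerms n)) (allFin (suc n))

allSubsets : (n : ℕ) → List (Subset n)
allSubsets zero    = [] ∷ []
allSubsets (suc n) = map (inside ∷_) (allSubsets n) ++ map (outside ∷_) (allSubsets n)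

image : ∀ {n} → Perm n → Subset n → Subset n
image w X = tabulate (λ j → lookup X (w ⟨$⟩ˡ j))

isId : ∀ {n} → Perm n → Bool
isId w = does (FinP.all? (λ i → w ⟨$⟩ʳ i FinP.≟ i))

subsetEq : ∀ {n} → Subset n → Subset n → Bool
subsetEq X Y = does (VecP.≡-dec Bool._≟_ X Y)

ω : ∀ {n} → Subset n → Subset n → ℕ
ω {n} B X = (∣ B ∩ X ∣ !) ℕ.* (∣ B ─ X ∣ !) ℕ.* (∣ X ─ B ∣ !) ℕ.* (∣ ∁ (B ∪ X) ∣ !)

module GroupAlgebra {c ℓ : Level} (R : CommutativeRing c ℓ) where
  open CommutativeRing R

  ι : ℕ → Carrier
  ι zero    = 0#
  ι (suc m) = 1# + ι m

  negOnePow : ℕ → Carrier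
  negOnePow zero    = 1#
  negOnePow (suc m) = - negOnePow m

  Σ : ∀ {a} {A : Set a} → List A → (A → Carrier) → Carrier
  Σ xs f = foldr (λ x acc → f x + acc) 0# xs

  -- The group algebra A = k[S_n]: an element is its coefficient function S_n → k.
  𝒜 : ℕ → Set c
  𝒜 n = Perm n → Carrier

  _≈ᴬ_ : ∀ {n} → 𝒜 n → 𝒜 n → Set ℓ
  f ≈ᴬ g = ∀ w → f w ≈ g w

  0ᴬ : ∀ {n} → 𝒜 n
  0ᴬ w = 0#

  scalar : ∀ {n} → Carrier → 𝒜 n
  scalar s w = if isId w then s else 0#

  1ᴬ : ∀ {n} → 𝒜 n
  1ᴬ = scalar 1#

  _-ᴬ_ : ∀ {n} → 𝒜 n → 𝒜 n → 𝒜 n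
  (f -ᴬ g) w = f w - g w

  _*ᴬ_ : ∀ {n} → 𝒜 n → 𝒜 n → 𝒜 n
  _*ᴬ_ {n} f g w = Σ (allPerms n) (λ u → f u * g (flip u ·ₚ w))

  ∇ : ∀ {n} → Subset n → Subset n → 𝒜 n
  ∇ Y X w = if subsetEq (image w X) Y then 1# else 0#

  δ : ∀ {n} → Subset n → Subset n → ℕ → Carrier
  δ {n} D X k =
    Σ (filter (λ B → B ⊆? D) (allSubsets n)) (λ B →
      if does (∣ B ∣ ℕP.≟ k)
      then ι (ω B X ℕ.* (k C ∣ B ∩ X ∣)) * negOnePow (k ∸ ∣ B ∩ X ∣)
      else 0#)

  sameSize : ∀ {n} → Subset n → List (Subset n)
  sameSize {n} D = filter (λ X → ∣ X ∣ ℕP.≟ ∣ D ∣) (allSubsets n)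

  ∇α : ∀ {n} → Subset n → (Subset n → Carrier) → 𝒜 n
  ∇α D α w = Σ (sameSize D) (λ X → α X * ∇ D X w)

  δα : ∀ {n} → Subset n → (Subset n → Carrier) → ℕ → Carrier
  δα D α k = Σ (sameSize D) (λ X → α X * δ D X k)

  ∏ᴬ : ∀ {n} → List ℕ → (ℕ → 𝒜 n) → 𝒜 n
  ∏ᴬ ks F = foldr (λ k acc → F k *ᴬ acc) 1ᴬ ks

-- Write x = ∇_{D,α}, d = |D|, and for scalars a_{X,l} (X a d-subset of [n], l ≤ d) put
-- y_a = Σ_w Σ_{X,l} a_{X,l} C(|D ∖ w(X)|, l) w.  As |w(X)| = d, the indicator of w(X) = D is
-- Σ_{l ≤ d} (-1)^l C(|D ∖ w(X)|, l), so x is itself of the form y_a.  Left multiplication by x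
-- sends y_a to y_{aT} for a matrix T with T_{lj} = 0 for l < j and T_{ll} = δ_{D,α,l}.  Indeed,
-- reading C(|D ∖ u⁻¹(W)|, l) as the number of l-subsets B ⊆ D with u(B) ∩ W = ∅ and counting the
-- u with u(X) = D and u(B) = E (there are ω_{B,X} of them if (X, B) and (D, E) have the same type,
-- and none otherwise) gives, for |W| = d,
--   Σ_u [u(X) = D] C(|D ∖ u⁻¹(W)|, l)
--     = Σ_{B ⊆ D, |B| = l} ω_{B,X} C(|D ∖ W|, |X ∩ B|) C(|∁D ∖ W|, |B ∖ X|),
-- and inclusion–exclusion re-expands each product in the binomials C(|D ∖ W|, j), j ≤ l.  Hence
-- x − δ_{D,α,k} maps the y_a with a supported on l ≤ k to ones supported on l < k, and the product
-- over k = 0, …, d annihilates x.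

{-# OPTIONS --safe #-}
module Submission where

open import Defs
open import Level using (Level)
open import Algebra.Bundles using (CommutativeRing)
import Algebra.Properties.CommutativeSemigroup as CommSemigroupProperties
open import Data.Bool as Bool using (Bool; true; false; if_then_else_; not; _∧_; T)
open import Data.Bool.Properties using (∧-zeroʳ)
open import Data.Fin using (Fin; zero; suc; punchIn)
import Data.Fin.Properties as FinP
open import Data.Fin.Permutation
  using (id; insert; remove; _⟨$⟩ʳ_; _⟨$⟩ˡ_; flip; inverseˡ; inverseʳ;
         insert-punchIn; insert-remove; punchIn-permute)
  renaming (_≈_ to _≈ₚ_)
open import Data.Fin.Subset using (Subset; Side; inside; outside; _∩_; _∪_; _─_; ∁; ∣_∣)
open import Data.Fin.Subset.Properties using (_⊆?_)
open import Data.List using (List; []; _∷_; map; foldr; concatMap; filter; _++_; allFin; upTo; applyUpTo)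
import Data.List.Properties as ListP
open import Data.Nat as ℕ using (ℕ; zero; suc; _∸_; _≤_; _<_; z≤n; s≤s; _!; NonZero)
import Data.Nat.Properties as ℕP
open import Data.Nat.Combinatorics
  using (_C_; nCk≡n!/k![n-k]!; k![n∸k]!∣n!; k>n⇒nCk≡0; nCk+nC[k+1]≡[n+1]C[k+1])
open import Data.Nat.DivMod using (m/n*n≡m)
open import Data.Nat.Solver using (module +-*-Solver)
open import Data.Product using (_×_; _,_; proj₁; proj₂)
open import Data.Sum using (_⊎_; inj₁; inj₂)
open import Data.Vec using (Vec; []; _∷_; lookup; removeAt)
import Data.Vec.Properties as VecP
open import Function using (_∘_; _$_)
open import Function.Bundles using (_⇔_; mk⇔; Equivalence)
open import Relation.Binary.Definitions using (tri<; tri≈; tri>)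
import Relation.Binary.PropositionalEquality as ≡
open ≡ using (_≡_; _≢_; cong; cong₂)
open import Relation.Nullary using (Dec; yes; no; does; _×-dec_)
open import Relation.Nullary.Decidable using (does-⇔; dec-true; dec-false; map′; T?)
open import Relation.Nullary.Negation using (contradiction)
open import Relation.Unary using (Pred; Decidable)

-- Permutations and images of subsets

infix 4 _≈ₚ?_
_≈ₚ?_ : ∀ {n} (u v : Perm n) → Dec (u ≈ₚ v)
u ≈ₚ? v = FinP.all? (λ i → u ⟨$⟩ʳ i FinP.≟ v ⟨$⟩ʳ i)

⟨$⟩ˡ-cong : ∀ {n} (u v : Perm n) → u ≈ₚ v → ∀ j → u ⟨$⟩ˡ j ≡ v ⟨$⟩ˡ j
⟨$⟩ˡ-cong u v u≈v j =
  ≡.trans (≡.sym (inverseˡ v)) (cong (v ⟨$⟩ˡ_) (≡.trans (≡.sym (u≈v (u ⟨$⟩ˡ j))) (inverseʳ u)))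

insert-≈ₚ : ∀ {n} {i} (π : Perm n) (v : Perm (suc n)) →
            i ≡ v ⟨$⟩ʳ zero → insert zero i π ≈ₚ v ⇔ π ≈ₚ remove zero v
insert-≈ₚ {i = i} π v ≡.refl = mk⇔ to from
  where
  to : insert zero i π ≈ₚ v → π ≈ₚ remove zero v
  to e k = FinP.punchIn-injective i _ _ $
    ≡.trans (≡.sym (insert-punchIn zero i π k))
            (≡.trans (e (suc k)) (punchIn-permute v zero k))
  from : π ≈ₚ remove zero v → insert zero i π ≈ₚ v
  from e zero    = ≡.refl
  from e (suc k) = ≡.trans (insert-punchIn zero i π k)
                     (≡.trans (cong (punchIn i) (e k)) (≡.sym (punchIn-permute v zero k)))

image-cong : ∀ {n} (u v : Perm n) (X : Subset n) → u ≈ₚ v → image u X ≡ image v X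
image-cong u v X u≈v = VecP.tabulate-cong (λ j → cong (lookup X) (⟨$⟩ˡ-cong u v u≈v j))

image-∘ : ∀ {n} (u w : Perm n) (X : Subset n) → image (flip u ·ₚ w) X ≡ image (flip u) (image w X)
image-∘ u w X = VecP.tabulate-cong (λ j → ≡.sym (VecP.lookup∘tabulate _ (u ⟨$⟩ʳ j)))

image≡⇔ : ∀ {n} (u : Perm n) (X Y : Subset n) →
          image u X ≡ Y ⇔ (∀ j → lookup Y (u ⟨$⟩ʳ j) ≡ lookup X j)
image≡⇔ u X Y = mk⇔ to from
  where
  to : image u X ≡ Y → ∀ j → lookup Y (u ⟨$⟩ʳ j) ≡ lookup X j
  to ≡.refl j = ≡.trans (VecP.lookup∘tabulate _ (u ⟨$⟩ʳ j)) (cong (lookup X) (inverseˡ u))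
  from : (∀ j → lookup Y (u ⟨$⟩ʳ j) ≡ lookup X j) → image u X ≡ Y
  from h = ≡.trans (VecP.tabulate-cong (λ j → ≡.trans (≡.sym (h (u ⟨$⟩ˡ j))) (cong (lookup Y) (inverseʳ u))))
                   (VecP.tabulate∘lookup Y)

removeAt-punchIn : ∀ {a} {A : Set a} {n} (xs : Vec A (suc n)) i j →
                   lookup (removeAt xs i) j ≡ lookup xs (punchIn i j)
removeAt-punchIn (x ∷ xs)     zero    j       = ≡.refl
removeAt-punchIn (x ∷ y ∷ xs) (suc i) zero    = ≡.refl
removeAt-punchIn (x ∷ y ∷ xs) (suc i) (suc j) = removeAt-punchIn (y ∷ xs) i j

image-insert : ∀ {n} (i : Fin (suc n)) (π : Perm n) x (X : Subset n) (Y : Subset (suc n)) →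
               image (insert zero i π) (x ∷ X) ≡ Y ⇔ (lookup Y i ≡ x × image π X ≡ removeAt Y i)
image-insert i π x X Y = mk⇔ to from
  where
  σ = insert zero i π
  shift : ∀ j → lookup (removeAt Y i) (π ⟨$⟩ʳ j) ≡ lookup Y (σ ⟨$⟩ʳ suc j)
  shift j = ≡.trans (removeAt-punchIn Y i _) (cong (lookup Y) (≡.sym (insert-punchIn zero i π j)))
  to : image σ (x ∷ X) ≡ Y → lookup Y i ≡ x × image π X ≡ removeAt Y i
  to e = h zero , Equivalence.from (image≡⇔ π X (removeAt Y i)) (λ j → ≡.trans (shift j) (h (suc j)))
    where h = Equivalence.to (image≡⇔ σ (x ∷ X) Y) e
  from : lookup Y i ≡ x × image π X ≡ removeAt Y i → image σ (x ∷ X) ≡ Y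
  from (Yi≡x , e) = Equivalence.from (image≡⇔ σ (x ∷ X) Y) h
    where
    h : ∀ j → lookup Y (σ ⟨$⟩ʳ j) ≡ lookup (x ∷ X) j
    h zero    = Yi≡x
    h (suc j) = ≡.trans (≡.sym (shift j)) (Equivalence.to (image≡⇔ π X _) e j)

subsetEq-insert : ∀ {n} (i : Fin (suc n)) (π : Perm n) x (X : Subset n) (Y : Subset (suc n)) →
  subsetEq (image (insert zero i π) (x ∷ X)) Y
  ≡ does (lookup Y i Bool.≟ x) ∧ subsetEq (image π X) (removeAt Y i)
subsetEq-insert i π x X Y = does-⇔ (image-insert i π x X Y) (VecP.≡-dec Bool._≟_ _ Y)
  ((lookup Y i Bool.≟ x) ×-dec VecP.≡-dec Bool._≟_ (image π X) (removeAt Y i))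

-- Joint counts of two subsets

fromBool : Bool → ℕ
fromBool b = if b then 1 else 0

count : ∀ {n} → Side → Side → Subset n → Subset n → ℕ
count p q []      []      = 0
count p q (x ∷ X) (y ∷ Y) = fromBool (does (x Bool.≟ p) ∧ does (y Bool.≟ q)) ℕ.+ count p q X Y

count-∷-self : ∀ {n} p q (X Y : Subset n) → count p q (p ∷ X) (q ∷ Y) ≡ suc (count p q X Y)
count-∷-self inside  inside  X Y = ≡.refl
count-∷-self inside  outside X Y = ≡.refl
count-∷-self outside inside  X Y = ≡.refl
count-∷-self outside outside X Y = ≡.refl

∣∩∣≡count : ∀ {n} (X Y : Subset n) → ∣ Y ∩ X ∣ ≡ count inside inside X Y
∣∩∣≡count []      []      = ≡.refl
∣∩∣≡count (x ∷ X) (y ∷ Y) with x | y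
... | inside  | inside  = cong suc (∣∩∣≡count X Y)
... | inside  | outside = ∣∩∣≡count X Y
... | outside | inside  = ∣∩∣≡count X Y
... | outside | outside = ∣∩∣≡count X Y

∣─∣≡count : ∀ {n} (X Y : Subset n) → ∣ Y ─ X ∣ ≡ count outside inside X Y
∣─∣≡count []      []      = ≡.refl
∣─∣≡count (x ∷ X) (y ∷ Y) with x | y
... | inside  | inside  = ∣─∣≡count X Y
... | inside  | outside = ∣─∣≡count X Y
... | outside | inside  = cong suc (∣─∣≡count X Y)
... | outside | outside = ∣─∣≡count X Y

∣─∣≡count′ : ∀ {n} (X Y : Subset n) → ∣ X ─ Y ∣ ≡ count inside outside X Y
∣─∣≡count′ []      []      = ≡.refl
∣─∣≡count′ (x ∷ X) (y ∷ Y) with x | y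
... | inside  | inside  = ∣─∣≡count′ X Y
... | inside  | outside = cong suc (∣─∣≡count′ X Y)
... | outside | inside  = ∣─∣≡count′ X Y
... | outside | outside = ∣─∣≡count′ X Y

∣∁∪∣≡count : ∀ {n} (X Y : Subset n) → ∣ ∁ (Y ∪ X) ∣ ≡ count outside outside X Y
∣∁∪∣≡count []      []      = ≡.refl
∣∁∪∣≡count (x ∷ X) (y ∷ Y) with x | y
... | inside  | inside  = ∣∁∪∣≡count X Y
... | inside  | outside = ∣∁∪∣≡count X Y
... | outside | inside  = ∣∁∪∣≡count X Y
... | outside | outside = cong suc (∣∁∪∣≡count X Y)

count-ii+io : ∀ {n} (X Y : Subset n) → count inside inside X Y ℕ.+ count inside outside X Y ≡ ∣ X ∣
count-ii+io []      []      = ≡.refl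
count-ii+io (x ∷ X) (y ∷ Y) with x | y
... | inside  | inside  = cong suc (count-ii+io X Y)
... | inside  | outside = ≡.trans (ℕP.+-suc _ _) (cong suc (count-ii+io X Y))
... | outside | inside  = count-ii+io X Y
... | outside | outside = count-ii+io X Y

count-ii+oi : ∀ {n} (X Y : Subset n) → count inside inside X Y ℕ.+ count outside inside X Y ≡ ∣ Y ∣
count-ii+oi []      []      = ≡.refl
count-ii+oi (x ∷ X) (y ∷ Y) with x | y
... | inside  | inside  = cong suc (count-ii+oi X Y)
... | inside  | outside = count-ii+oi X Y
... | outside | inside  = ≡.trans (ℕP.+-suc _ _) (cong suc (count-ii+oi X Y))
... | outside | outside = count-ii+oi X Y

count-oi+oo+∣∣ : ∀ {n} (X Y : Subset n) →
                 count outside inside X Y ℕ.+ count outside outside X Y ℕ.+ ∣ X ∣ ≡ n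
count-oi+oo+∣∣ []      []      = ≡.refl
count-oi+oo+∣∣ (x ∷ X) (y ∷ Y) with x | y
... | inside  | inside  = ≡.trans (ℕP.+-suc _ _) (cong suc (count-oi+oo+∣∣ X Y))
... | inside  | outside = ≡.trans (ℕP.+-suc _ _) (cong suc (count-oi+oo+∣∣ X Y))
... | outside | inside  = cong suc (count-oi+oo+∣∣ X Y)
... | outside | outside = ≡.trans (cong (ℕ._+ ∣ X ∣) (ℕP.+-suc _ _)) (cong suc (count-oi+oo+∣∣ X Y))

count-oi≡count-io : ∀ {n} (X Y : Subset n) → ∣ Y ∣ ≡ ∣ X ∣ →
                    count outside inside X Y ≡ count inside outside X Y
count-oi≡count-io X Y ∣Y∣≡∣X∣ = ℕP.+-cancelˡ-≡ (count inside inside X Y) _ _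
  (≡.trans (count-ii+oi X Y) (≡.trans ∣Y∣≡∣X∣ (≡.sym (count-ii+io X Y))))

count-io+oo : ∀ {n} (X Y : Subset n) → ∣ Y ∣ ≡ ∣ X ∣ →
              count inside outside X Y ℕ.+ count outside outside X Y ≡ n ∸ ∣ X ∣
count-io+oo X Y ∣Y∣≡∣X∣ = ≡.trans (≡.sym (ℕP.m+n∸n≡m _ ∣ X ∣)) (cong (_∸ ∣ X ∣) (≡.trans
  (cong (λ k → k ℕ.+ count outside outside X Y ℕ.+ ∣ X ∣) (≡.sym (count-oi≡count-io X Y ∣Y∣≡∣X∣)))
  (count-oi+oo+∣∣ X Y)))

count-io-self : ∀ {n} (X : Subset n) → count inside outside X X ≡ 0
count-io-self []            = ≡.refl
count-io-self (inside ∷ X)  = count-io-self X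
count-io-self (outside ∷ X) = count-io-self X

count-io≡0∧count-oi≡0⇒≡ : ∀ {n} (X Y : Subset n) →
  count inside outside X Y ≡ 0 → count outside inside X Y ≡ 0 → Y ≡ X
count-io≡0∧count-oi≡0⇒≡ []            []            _  _  = ≡.refl
count-io≡0∧count-oi≡0⇒≡ (inside ∷ X)  (inside ∷ Y)  e₁ e₂ =
  cong (inside ∷_) (count-io≡0∧count-oi≡0⇒≡ X Y e₁ e₂)
count-io≡0∧count-oi≡0⇒≡ (outside ∷ X) (outside ∷ Y) e₁ e₂ =
  cong (outside ∷_) (count-io≡0∧count-oi≡0⇒≡ X Y e₁ e₂)

subsetEq≡count-io≟0 : ∀ {n} (X Y : Subset n) → ∣ Y ∣ ≡ ∣ X ∣ →
                      subsetEq Y X ≡ does (count inside outside X Y ℕ.≟ 0)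
subsetEq≡count-io≟0 X Y ∣Y∣≡∣X∣ =
  does-⇔ (mk⇔ to from) (VecP.≡-dec Bool._≟_ Y X) (count inside outside X Y ℕ.≟ 0)
  where
  to : Y ≡ X → count inside outside X Y ≡ 0
  to ≡.refl = count-io-self X
  from : count inside outside X Y ≡ 0 → Y ≡ X
  from io≡0 = count-io≡0∧count-oi≡0⇒≡ X Y io≡0 (≡.trans (count-oi≡count-io X Y ∣Y∣≡∣X∣) io≡0)

count-removeAt : ∀ {n} p q (X Y : Subset (suc n)) i →
  count p q X Y ≡ fromBool (does (lookup X i Bool.≟ p) ∧ does (lookup Y i Bool.≟ q))
                  ℕ.+ count p q (removeAt X i) (removeAt Y i)
count-removeAt p q (x ∷ X)      (y ∷ Y)      zero    = ≡.refl
count-removeAt p q (x ∷ x′ ∷ X) (y ∷ y′ ∷ Y) (suc i) =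
  ≡.trans (cong (here ℕ.+_) (count-removeAt p q (x′ ∷ X) (y′ ∷ Y) i))
          (x∙yz≈y∙xz here there (count p q (removeAt (x′ ∷ X) i) (removeAt (y′ ∷ Y) i)))
  where
  open CommSemigroupProperties ℕP.+-commutativeSemigroup
  here there : ℕ
  here  = fromBool (does (x Bool.≟ p) ∧ does (y Bool.≟ q))
  there = fromBool (does (lookup (x′ ∷ X) i Bool.≟ p) ∧ does (lookup (y′ ∷ Y) i Bool.≟ q))

∣∷∣ : ∀ {n} x (X : Subset n) → ∣ x ∷ X ∣ ≡ fromBool x ℕ.+ ∣ X ∣
∣∷∣ inside  X = ≡.refl
∣∷∣ outside X = ≡.refl

∣∣-removeAt : ∀ {n} (X : Subset (suc n)) i → ∣ X ∣ ≡ fromBool (lookup X i) ℕ.+ ∣ removeAt X i ∣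
∣∣-removeAt (x ∷ X)      zero    = ∣∷∣ x X
∣∣-removeAt (x ∷ x′ ∷ X) (suc i) = begin
  ∣ x ∷ x′ ∷ X ∣                              ≡⟨ ∣∷∣ x (x′ ∷ X) ⟩
  fromBool x ℕ.+ ∣ x′ ∷ X ∣                   ≡⟨ cong (fromBool x ℕ.+_) (∣∣-removeAt (x′ ∷ X) i) ⟩
  fromBool x ℕ.+ (fromBool xᵢ ℕ.+ ∣ Xᵢ ∣)     ≡⟨ x∙yz≈y∙xz (fromBool x) (fromBool xᵢ) ∣ Xᵢ ∣ ⟩
  fromBool xᵢ ℕ.+ (fromBool x ℕ.+ ∣ Xᵢ ∣)     ≡⟨ cong (fromBool xᵢ ℕ.+_) (∣∷∣ x Xᵢ) ⟨
  fromBool xᵢ ℕ.+ ∣ x ∷ Xᵢ ∣                  ∎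
  where
  open ≡.≡-Reasoning
  open CommSemigroupProperties ℕP.+-commutativeSemigroup
  xᵢ : Bool
  xᵢ = lookup (x′ ∷ X) i
  Xᵢ : Subset _
  Xᵢ = removeAt (x′ ∷ X) i

∣image∣ : ∀ {n} (u : Perm n) (X : Subset n) → ∣ image u X ∣ ≡ ∣ X ∣
∣image∣ {zero}  u []      = ≡.refl
∣image∣ {suc n} u (x ∷ X) = begin
  ∣ Y ∣                                       ≡⟨ ∣∣-removeAt Y i ⟩
  fromBool (lookup Y i) ℕ.+ ∣ removeAt Y i ∣  ≡⟨ cong₂ (λ b Z → fromBool b ℕ.+ ∣ Z ∣) Yᵢ≡x (≡.sym image≡) ⟩
  fromBool x ℕ.+ ∣ image π X ∣                ≡⟨ cong (fromBool x ℕ.+_) (∣image∣ π X) ⟩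
  fromBool x ℕ.+ ∣ X ∣                        ≡⟨ ∣∷∣ x X ⟨
  ∣ x ∷ X ∣                                   ∎
  where
  open ≡.≡-Reasoning
  i = u ⟨$⟩ʳ zero
  π = remove zero u
  Y = image u (x ∷ X)
  decomposed : lookup Y i ≡ x × image π X ≡ removeAt Y i
  decomposed = Equivalence.to (image-insert i π x X Y)
                              (image-cong (insert zero i π) u (x ∷ X) (insert-remove zero u))
  Yᵢ≡x = proj₁ decomposed
  image≡ = proj₂ decomposed

ω′ : ∀ {n} → Subset n → Subset n → ℕ
ω′ X Y = count inside inside X Y ! ℕ.* count outside inside X Y !
         ℕ.* count inside outside X Y ! ℕ.* count outside outside X Y !

ω≡ω′ : ∀ {n} (X Y : Subset n) → ω Y X ≡ ω′ X Y
ω≡ω′ X Y rewrite ∣∩∣≡count X Y | ∣─∣≡count X Y | ∣─∣≡count′ X Y | ∣∁∪∣≡count X Y =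
  ≡.refl

ω′-∷ : ∀ {n} p q (X Y : Subset n) → ω′ (p ∷ X) (q ∷ Y) ≡ suc (count p q X Y) ℕ.* ω′ X Y
ω′-∷ p q X Y = factor p q
  where
  open +-*-Solver
  a b c d : ℕ
  a = count inside inside X Y !
  b = count outside inside X Y !
  c = count inside outside X Y !
  d = count outside outside X Y !
  factor : ∀ p q → ω′ (p ∷ X) (q ∷ Y) ≡ suc (count p q X Y) ℕ.* ω′ X Y
  factor inside  inside  = solve 5 (λ s a b c d → s :* a :* b :* c :* d := s :* (a :* b :* c :* d)) ≡.refl
                         (suc (count inside inside X Y)) a b c d
  factor outside inside  = solve 5 (λ s a b c d → a :* (s :* b) :* c :* d := s :* (a :* b :* c :* d)) ≡.refl
                         (suc (count outside inside X Y)) a b c d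
  factor inside  outside = solve 5 (λ s a b c d → a :* b :* (s :* c) :* d := s :* (a :* b :* c :* d)) ≡.refl
                         (suc (count inside outside X Y)) a b c d
  factor outside outside = solve 5 (λ s a b c d → a :* b :* c :* (s :* d) := s :* (a :* b :* c :* d)) ≡.refl
                         (suc (count outside outside X Y)) a b c d

SameType : ∀ {n} (X Y X′ Y′ : Subset n) → Set
SameType X Y X′ Y′ = ∀ p q → count p q X Y ≡ count p q X′ Y′

sameType? : ∀ {n} (X Y X′ Y′ : Subset n) → Dec (SameType X Y X′ Y′)
sameType? X Y X′ Y′ =
  map′ to from (≟ inside inside ×-dec ≟ outside inside ×-dec ≟ inside outside ×-dec ≟ outside outside)
  where
  ≟ : ∀ p q → Dec (count p q X Y ≡ count p q X′ Y′)
  ≟ p q = count p q X Y ℕ.≟ count p q X′ Y′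
  to : _ × _ × _ × _ → SameType X Y X′ Y′
  to (ii , oi , io , oo) inside  inside  = ii
  to (ii , oi , io , oo) outside inside  = oi
  to (ii , oi , io , oo) inside  outside = io
  to (ii , oi , io , oo) outside outside = oo
  from : SameType X Y X′ Y′ → _ × _ × _ × _
  from t = t inside inside , t outside inside , t inside outside , t outside outside

sameType-removeAt : ∀ {n} x y (X Y : Subset n) (X′ Y′ : Subset (suc n)) i →
  lookup X′ i ≡ x → lookup Y′ i ≡ y →
  SameType X Y (removeAt X′ i) (removeAt Y′ i) ⇔ SameType (x ∷ X) (y ∷ Y) X′ Y′
sameType-removeAt x y X Y X′ Y′ i ≡.refl ≡.refl = mk⇔
  (λ t p q → ≡.trans (cong (_ ℕ.+_) (t p q)) (≡.sym (count-removeAt p q X′ Y′ i)))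
  (λ t p q → ℕP.+-cancelˡ-≡ _ _ _ (≡.trans (t p q) (count-removeAt p q X′ Y′ i)))

sameType⇔ : ∀ {n} (X Y X′ Y′ : Subset n) → ∣ X ∣ ≡ ∣ X′ ∣ →
  SameType X Y X′ Y′ ⇔ (count inside inside X Y ≡ count inside inside X′ Y′ ×
                        count outside inside X Y ≡ count outside inside X′ Y′)
sameType⇔ {n} X Y X′ Y′ ∣X∣≡∣X′∣ = mk⇔ (λ t → t inside inside , t outside inside) from
  where
  open ≡.≡-Reasoning
  from : _ → SameType X Y X′ Y′
  from (ii , oi) inside  inside  = ii
  from (ii , oi) outside inside  = oi
  from (ii , oi) inside  outside = ℕP.+-cancelˡ-≡ (count inside inside X Y) _ _ (begin
    count inside inside X Y ℕ.+ count inside outside X Y      ≡⟨ count-ii+io X Y ⟩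
    ∣ X ∣                                                     ≡⟨ ∣X∣≡∣X′∣ ⟩
    ∣ X′ ∣                                                    ≡⟨ count-ii+io X′ Y′ ⟨
    count inside inside X′ Y′ ℕ.+ count inside outside X′ Y′  ≡⟨ cong (ℕ._+ count inside outside X′ Y′) ii ⟨
    count inside inside X Y ℕ.+ count inside outside X′ Y′    ∎)
  from (ii , oi) outside outside = ℕP.+-cancelˡ-≡ (count outside inside X Y) _ _ (ℕP.+-cancelʳ-≡ ∣ X ∣ _ _ (begin
    count outside inside X Y ℕ.+ count outside outside X Y ℕ.+ ∣ X ∣
      ≡⟨ count-oi+oo+∣∣ X Y ⟩
    n
      ≡⟨ count-oi+oo+∣∣ X′ Y′ ⟨
    count outside inside X′ Y′ ℕ.+ count outside outside X′ Y′ ℕ.+ ∣ X′ ∣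
      ≡⟨ cong₂ (λ a b → a ℕ.+ count outside outside X′ Y′ ℕ.+ b) oi ∣X∣≡∣X′∣ ⟨
    count outside inside X Y ℕ.+ count outside outside X′ Y′ ℕ.+ ∣ X ∣
      ∎))


disjoint : ∀ {n} → Subset n → Subset n → Bool
disjoint []      []      = true
disjoint (x ∷ X) (y ∷ Y) = not (x ∧ y) ∧ disjoint X Y

T-disjoint : ∀ {n} (X Y : Subset n) → T (disjoint X Y) ⇔ (∀ i → lookup X i ∧ lookup Y i ≡ false)
T-disjoint X Y = mk⇔ (to X Y) (from X Y)
  where
  to : ∀ {n} (X Y : Subset n) → T (disjoint X Y) → ∀ i → lookup X i ∧ lookup Y i ≡ false
  to (x ∷ X) (y ∷ Y) d i with x ∧ y in x∧y | i
  to (x ∷ X) (y ∷ Y) d i | false | zero  = x∧y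
  to (x ∷ X) (y ∷ Y) d i | false | suc j = to X Y d j
  from : ∀ {n} (X Y : Subset n) → (∀ i → lookup X i ∧ lookup Y i ≡ false) → T (disjoint X Y)
  from []      []      h = _
  from (x ∷ X) (y ∷ Y) h rewrite h zero = from X Y (h ∘ suc)

disjoint-image : ∀ {n} (u : Perm n) (X Y : Subset n) → disjoint X (image (flip u) Y) ≡ disjoint (image u X) Y
disjoint-image u X Y = does-⇔ (mk⇔ to from) (T? (disjoint X Y′)) (T? (disjoint X′ Y))
  where
  X′ = image u X
  Y′ = image (flip u) Y
  X′-lookup : ∀ i → lookup X′ (u ⟨$⟩ʳ i) ≡ lookup X i
  X′-lookup i = Equivalence.to (image≡⇔ u X X′) ≡.refl i
  Y′-lookup : ∀ j → lookup Y′ (u ⟨$⟩ˡ j) ≡ lookup Y j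
  Y′-lookup j = Equivalence.to (image≡⇔ (flip u) Y Y′) ≡.refl j
  to : T (disjoint X Y′) → T (disjoint X′ Y)
  to d = Equivalence.from (T-disjoint X′ Y) λ j →
    ≡.trans (cong₂ _∧_ (≡.trans (cong (lookup X′) (≡.sym (inverseʳ u))) (X′-lookup (u ⟨$⟩ˡ j)))
                       (≡.sym (Y′-lookup j)))
            (Equivalence.to (T-disjoint X Y′) d (u ⟨$⟩ˡ j))
  from : T (disjoint X′ Y) → T (disjoint X Y′)
  from d = Equivalence.from (T-disjoint X Y′) λ i →
    ≡.trans (cong₂ _∧_ (≡.sym (X′-lookup i))
                       (≡.trans (cong (lookup Y′) (≡.sym (inverseˡ u))) (Y′-lookup (u ⟨$⟩ʳ i))))
            (Equivalence.to (T-disjoint X′ Y) d (u ⟨$⟩ʳ i))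

-- Binomial coefficients

[a+b]Ca*a!*b!≡[a+b]! : ∀ a b → ((a ℕ.+ b) C a) ℕ.* (a ! ℕ.* b !) ≡ (a ℕ.+ b) !
[a+b]Ca*a!*b!≡[a+b]! a b =
  ≡.subst (λ c → ((a ℕ.+ b) C a) ℕ.* (a ! ℕ.* c !) ≡ (a ℕ.+ b) !) (ℕP.m+n∸m≡n a b)
    (≡.trans (cong (ℕ._* (a ! ℕ.* (a ℕ.+ b ∸ a) !)) (nCk≡n!/k![n-k]! a≤a+b))
             (m/n*n≡m {{ℕP._!*_!≢0 a (a ℕ.+ b ∸ a)}} (k![n∸k]!∣n! a≤a+b)))
  where a≤a+b = ℕP.m≤m+n a b

private
  trinomial-revision-+ : ∀ i r c →
    ((i ℕ.+ r) C i) ℕ.* ((i ℕ.+ r ℕ.+ c) C (i ℕ.+ r)) ≡ ((i ℕ.+ r ℕ.+ c) C i) ℕ.* ((r ℕ.+ c) C r)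
  trinomial-revision-+ i r c = ℕP.*-cancelʳ-≡ _ _ (i ! ℕ.* r ! ℕ.* c !) {{i!r!c!≢0}} (≡.trans viaIR (≡.sym viaRC))
    where
    open ≡.≡-Reasoning
    open +-*-Solver
    i!r!c!≢0 : NonZero (i ! ℕ.* r ! ℕ.* c !)
    i!r!c!≢0 = ℕP.m*n≢0 _ _ {{ℕP._!*_!≢0 i r}} {{ℕP._!≢0 c}}
    viaIR : ((i ℕ.+ r) C i) ℕ.* ((i ℕ.+ r ℕ.+ c) C (i ℕ.+ r)) ℕ.* (i ! ℕ.* r ! ℕ.* c !) ≡ (i ℕ.+ r ℕ.+ c) !
    viaIR = begin
      ((i ℕ.+ r) C i) ℕ.* ((i ℕ.+ r ℕ.+ c) C (i ℕ.+ r)) ℕ.* (i ! ℕ.* r ! ℕ.* c !)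
        ≡⟨ solve 5 (λ x y a b c → x :* y :* (a :* b :* c) := y :* ((x :* (a :* b)) :* c)) ≡.refl
                 ((i ℕ.+ r) C i) ((i ℕ.+ r ℕ.+ c) C (i ℕ.+ r)) (i !) (r !) (c !) ⟩
      ((i ℕ.+ r ℕ.+ c) C (i ℕ.+ r)) ℕ.* (((i ℕ.+ r) C i) ℕ.* (i ! ℕ.* r !) ℕ.* c !)
        ≡⟨ cong (λ z → ((i ℕ.+ r ℕ.+ c) C (i ℕ.+ r)) ℕ.* (z ℕ.* c !)) ([a+b]Ca*a!*b!≡[a+b]! i r) ⟩
      ((i ℕ.+ r ℕ.+ c) C (i ℕ.+ r)) ℕ.* ((i ℕ.+ r) ! ℕ.* c !)
        ≡⟨ [a+b]Ca*a!*b!≡[a+b]! (i ℕ.+ r) c ⟩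
      (i ℕ.+ r ℕ.+ c) ! ∎
    viaRC : ((i ℕ.+ r ℕ.+ c) C i) ℕ.* ((r ℕ.+ c) C r) ℕ.* (i ! ℕ.* r ! ℕ.* c !) ≡ (i ℕ.+ r ℕ.+ c) !
    viaRC = begin
      ((i ℕ.+ r ℕ.+ c) C i) ℕ.* ((r ℕ.+ c) C r) ℕ.* (i ! ℕ.* r ! ℕ.* c !)
        ≡⟨ solve 5 (λ z v a b c → z :* v :* (a :* b :* c) := z :* (a :* (v :* (b :* c)))) ≡.refl
                 ((i ℕ.+ r ℕ.+ c) C i) ((r ℕ.+ c) C r) (i !) (r !) (c !) ⟩
      ((i ℕ.+ r ℕ.+ c) C i) ℕ.* (i ! ℕ.* (((r ℕ.+ c) C r) ℕ.* (r ! ℕ.* c !)))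
        ≡⟨ cong (λ z → ((i ℕ.+ r ℕ.+ c) C i) ℕ.* (i ! ℕ.* z)) ([a+b]Ca*a!*b!≡[a+b]! r c) ⟩
      ((i ℕ.+ r ℕ.+ c) C i) ℕ.* (i ! ℕ.* (r ℕ.+ c) !)
        ≡⟨ ≡.subst (λ w → (w C i) ℕ.* (i ! ℕ.* (r ℕ.+ c) !) ≡ w !) (≡.sym (ℕP.+-assoc i r c))
                   ([a+b]Ca*a!*b!≡[a+b]! i (r ℕ.+ c)) ⟩
      (i ℕ.+ r ℕ.+ c) ! ∎

trinomial-revision : ∀ i r s → ((i ℕ.+ r) C i) ℕ.* (s C (i ℕ.+ r)) ≡ (s C i) ℕ.* ((s ∸ i) C r)
trinomial-revision i r s with i ℕ.+ r ℕP.≤? s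
... | yes i+r≤s =
  ≡.subst (λ w → ((i ℕ.+ r) C i) ℕ.* (w C (i ℕ.+ r)) ≡ (w C i) ℕ.* ((w ∸ i) C r)) (ℕP.m+[n∸m]≡n i+r≤s)
    (≡.subst (λ v → ((i ℕ.+ r) C i) ℕ.* ((i ℕ.+ r ℕ.+ c) C (i ℕ.+ r)) ≡ ((i ℕ.+ r ℕ.+ c) C i) ℕ.* (v C r))
             (≡.sym i+r+c∸i≡r+c) (trinomial-revision-+ i r c))
  where
  c = s ∸ (i ℕ.+ r)
  i+r+c∸i≡r+c : i ℕ.+ r ℕ.+ c ∸ i ≡ r ℕ.+ c
  i+r+c∸i≡r+c = ≡.trans (cong (_∸ i) (ℕP.+-assoc i r c)) (ℕP.m+n∸m≡n i (r ℕ.+ c))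
... | no i+r≰s = ≡.trans (cong (((i ℕ.+ r) C i) ℕ.*_) (k>n⇒nCk≡0 s<i+r))
                   (≡.trans (ℕP.*-zeroʳ ((i ℕ.+ r) C i)) (≡.sym rhs≡0))
  where
  s<i+r = ℕP.≰⇒> i+r≰s
  rhs≡0 : (s C i) ℕ.* ((s ∸ i) C r) ≡ 0
  rhs≡0 with i ℕP.≤? s
  ... | yes i≤s = ≡.trans (cong ((s C i) ℕ.*_) (k>n⇒nCk≡0 s∸i<r)) (ℕP.*-zeroʳ (s C i))
    where s∸i<r = ≡.subst (s ∸ i <_) (ℕP.m+n∸m≡n i r) (ℕP.∸-monoˡ-< s<i+r i≤s)
  ... | no i≰s = cong (ℕ._* ((s ∸ i) C r)) (k>n⇒nCk≡0 (ℕP.≰⇒> i≰s))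

module _ {c ℓ : Level} (R : CommutativeRing c ℓ) where

  open CommutativeRing R hiding (zero)
  open GroupAlgebra R
  open import Relation.Binary.Reasoning.Setoid setoid
  open import Algebra.Properties.Ring ring using (-‿distribˡ-*; -‿+-comm; -0#≈0#)
  open CommSemigroupProperties +-commutativeSemigroup using (interchange)

  -- Finite sums in a commutative ring

  private variable
    ℓ′ : Level
    A B : Set ℓ′

  Σ-cong : ∀ (xs : List A) {f g : A → Carrier} → (∀ x → f x ≈ g x) → Σ xs f ≈ Σ xs g
  Σ-cong []       f≈g = refl
  Σ-cong (x ∷ xs) f≈g = +-cong (f≈g x) (Σ-cong xs f≈g)

  Σ-≈0 : ∀ (xs : List A) {f : A → Carrier} → (∀ x → f x ≈ 0#) → Σ xs f ≈ 0#
  Σ-≈0 []       f≈0 = refl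
  Σ-≈0 (x ∷ xs) f≈0 = trans (+-cong (f≈0 x) (Σ-≈0 xs f≈0)) (+-identityˡ 0#)

  Σ-distrib-+ : ∀ (xs : List A) (f g : A → Carrier) → Σ xs (λ x → f x + g x) ≈ Σ xs f + Σ xs g
  Σ-distrib-+ []       f g = sym (+-identityˡ 0#)
  Σ-distrib-+ (x ∷ xs) f g = trans (+-congˡ (Σ-distrib-+ xs f g)) (interchange _ _ _ _)

  *-distribˡ-Σ : ∀ (xs : List A) a (f : A → Carrier) → a * Σ xs f ≈ Σ xs (λ x → a * f x)
  *-distribˡ-Σ []       a f = zeroʳ a
  *-distribˡ-Σ (x ∷ xs) a f = trans (distribˡ a _ _) (+-congˡ (*-distribˡ-Σ xs a f))

  *-distribʳ-Σ : ∀ (xs : List A) a (f : A → Carrier) → Σ xs f * a ≈ Σ xs (λ x → f x * a)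
  *-distribʳ-Σ xs a f = trans (*-comm _ a) (trans (*-distribˡ-Σ xs a f) (Σ-cong xs (λ x → *-comm a (f x))))

  -‿distrib-Σ : ∀ (xs : List A) (f : A → Carrier) → - Σ xs f ≈ Σ xs (λ x → - f x)
  -‿distrib-Σ []       f = -0#≈0#
  -‿distrib-Σ (x ∷ xs) f = trans (sym (-‿+-comm _ _)) (+-congˡ (-‿distrib-Σ xs f))

  Σ-distrib-- : ∀ (xs : List A) (f g : A → Carrier) → Σ xs (λ x → f x - g x) ≈ Σ xs f - Σ xs g
  Σ-distrib-- xs f g = trans (Σ-distrib-+ xs f (λ x → - g x)) (+-congˡ (sym (-‿distrib-Σ xs g)))

  Σ-comm : ∀ (xs : List A) (ys : List B) (f : A → B → Carrier) →
           Σ xs (λ x → Σ ys (f x)) ≈ Σ ys (λ y → Σ xs (λ x → f x y))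
  Σ-comm []       ys f = sym (Σ-≈0 ys (λ _ → refl))
  Σ-comm (x ∷ xs) ys f = trans (+-congˡ (Σ-comm xs ys f)) (sym (Σ-distrib-+ ys (f x) _))

  Σ-++ : ∀ (xs ys : List A) (f : A → Carrier) → Σ (xs ++ ys) f ≈ Σ xs f + Σ ys f
  Σ-++ []       ys f = sym (+-identityˡ _)
  Σ-++ (x ∷ xs) ys f = trans (+-congˡ (Σ-++ xs ys f)) (sym (+-assoc _ _ _))

  Σ-map : ∀ (xs : List A) (g : A → B) (f : B → Carrier) → Σ (map g xs) f ≈ Σ xs (f ∘ g)
  Σ-map []       g f = refl
  Σ-map (x ∷ xs) g f = +-congˡ (Σ-map xs g f)

  Σ-concatMap : ∀ (xs : List A) (g : A → List B) (f : B → Carrier) →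
                Σ (concatMap g xs) f ≈ Σ xs (λ x → Σ (g x) f)
  Σ-concatMap []       g f = refl
  Σ-concatMap (x ∷ xs) g f = trans (Σ-++ (g x) _ f) (+-congˡ (Σ-concatMap xs g f))

  Σ-collectʳ : ∀ (xs : List A) (js : List B) (h : A → B → Carrier) (Q : B → Carrier) →
               Σ xs (λ z → Σ js (λ j → h z j * Q j)) ≈ Σ js (λ j → Σ xs (λ z → h z j) * Q j)
  Σ-collectʳ xs js h Q = trans (Σ-comm xs js _) (Σ-cong js (λ j → sym (*-distribʳ-Σ xs (Q j) (λ z → h z j))))

  *-collectʳ : ∀ (js : List B) a (h Q : B → Carrier) →
               a * Σ js (λ j → h j * Q j) ≈ Σ js (λ j → (a * h j) * Q j)
  *-collectʳ js a h Q = trans (*-distribˡ-Σ js a _) (Σ-cong js (λ j → sym (*-assoc _ _ _)))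

  +-cong-0ˡ : ∀ {x y z} → x ≈ 0# → y ≈ z → x + y ≈ z
  +-cong-0ˡ x≈0 y≈z = trans (+-cong x≈0 y≈z) (+-identityˡ _)

  guard : Bool → Carrier → Carrier
  guard b x = if b then x else 0#

  Σ-filter : ∀ {p} {P : Pred A p} (P? : Decidable P) (xs : List A) (f : A → Carrier) →
             Σ (filter P? xs) f ≈ Σ xs (λ x → guard (does (P? x)) (f x))
  Σ-filter P? []       f = refl
  Σ-filter P? (x ∷ xs) f with does (P? x)
  ... | true  = +-congˡ (Σ-filter P? xs f)
  ... | false = trans (Σ-filter P? xs f) (sym (+-identityˡ _))

  guard-cong : ∀ {p} {P : Set p} (P? : Dec P) {x y} → (P → x ≈ y) → guard (does P?) x ≈ guard (does P?) y
  guard-cong (yes p) x≈y = x≈y p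
  guard-cong (no _)  x≈y = refl

  guard-0# : ∀ b → guard b 0# ≈ 0#
  guard-0# true  = refl
  guard-0# false = refl

  guard-≈0 : ∀ b {x} → x ≈ 0# → guard b x ≈ 0#
  guard-≈0 true  x≈0 = x≈0
  guard-≈0 false x≈0 = refl

  guard-*ˡ : ∀ b x y → x * guard b y ≈ guard b (x * y)
  guard-*ˡ true  x y = refl
  guard-*ˡ false x y = zeroʳ x

  guard-*ʳ : ∀ b x y → guard b x * y ≈ guard b (x * y)
  guard-*ʳ true  x y = refl
  guard-*ʳ false x y = zeroˡ y

  guard-comm : ∀ a b x → guard a (guard b x) ≡ guard b (guard a x)
  guard-comm true  b     x = ≡.refl
  guard-comm false true  x = ≡.refl
  guard-comm false false x = ≡.refl

  guard-interchange : ∀ a s c t x → guard (a ∧ s) (guard (c ∧ t) x) ≡ guard (a ∧ c) (guard s (guard t x))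
  guard-interchange false s     c     t x = ≡.refl
  guard-interchange true  s     true  t x = ≡.refl
  guard-interchange true  true  false t x = ≡.refl
  guard-interchange true  false false t x = ≡.refl

  guard-1#-* : ∀ a b x → guard a 1# * guard b x ≈ x * guard a (guard b 1#)
  guard-1#-* true  true  x = trans (*-identityˡ x) (sym (*-identityʳ x))
  guard-1#-* true  false x = trans (zeroʳ _) (sym (zeroʳ x))
  guard-1#-* false b     x = trans (zeroˡ _) (sym (zeroʳ x))

  Σ-guard : ∀ (xs : List A) b (f : A → Carrier) → Σ xs (λ x → guard b (f x)) ≈ guard b (Σ xs f)
  Σ-guard xs true  f = refl
  Σ-guard xs false f = Σ-≈0 xs (λ _ → refl)

  guard-collectʳ : ∀ (js : List B) b (h Q : B → Carrier) →
                   guard b (Σ js (λ j → h j * Q j)) ≈ Σ js (λ j → guard b (h j) * Q j)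

  guard-collectʳ js true  h Q = refl
  guard-collectʳ js false h Q = sym (Σ-≈0 js (λ _ → zeroˡ _))

  ι-+ : ∀ m k → ι (m ℕ.+ k) ≈ ι m + ι k
  ι-+ zero    k = sym (+-identityˡ _)
  ι-+ (suc m) k = trans (+-congˡ (ι-+ m k)) (sym (+-assoc _ _ _))

  ι-* : ∀ m k → ι (m ℕ.* k) ≈ ι m * ι k
  ι-* zero    k = sym (zeroˡ _)
  ι-* (suc m) k = begin
    ι (k ℕ.+ m ℕ.* k)        ≈⟨ ι-+ k (m ℕ.* k) ⟩
    ι k + ι (m ℕ.* k)        ≈⟨ +-cong (sym (*-identityˡ _)) (ι-* m k) ⟩
    1# * ι k + ι m * ι k     ≈⟨ distribʳ _ _ _ ⟨
    (1# + ι m) * ι k         ∎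

  ι-1 : ι 1 ≈ 1#
  ι-1 = +-identityʳ 1#

  guard≈ι* : ∀ b x → guard b x ≈ ι (fromBool b) * x
  guard≈ι* true  x = sym (trans (*-congʳ ι-1) (*-identityˡ x))
  guard≈ι* false x = sym (zeroˡ x)

  ι-pascal : ∀ s k → ι (suc s C suc k) ≈ ι (s C k) + ι (s C suc k)
  ι-pascal s k = trans (reflexive (≡.cong ι (≡.sym (nCk+nC[k+1]≡[n+1]C[k+1] s k)))) (ι-+ (s C k) (s C suc k))

  Σ-applyUpTo : ∀ K (g : ℕ → ℕ) (f : ℕ → Carrier) → Σ (applyUpTo g K) f ≈ Σ (upTo K) (f ∘ g)
  Σ-applyUpTo zero    g f = refl
  Σ-applyUpTo (suc K) g f = +-congˡ (trans (Σ-applyUpTo K (g ∘ suc) f) (sym (Σ-applyUpTo K suc (f ∘ g))))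

  Σ-upTo-suc : ∀ K (f : ℕ → Carrier) → Σ (upTo (suc K)) f ≈ f 0 + Σ (upTo K) (f ∘ suc)
  Σ-upTo-suc K f = +-congˡ (Σ-applyUpTo K suc f)

  Σ-upTo-∷ʳ : ∀ K (f : ℕ → Carrier) → Σ (upTo (suc K)) f ≈ Σ (upTo K) f + f K
  Σ-upTo-∷ʳ zero    f = trans (+-identityʳ _) (sym (+-identityˡ _))
  Σ-upTo-∷ʳ (suc K) f = begin
    Σ (upTo (suc (suc K))) f                       ≈⟨ Σ-upTo-suc (suc K) f ⟩
    f 0 + Σ (upTo (suc K)) (f ∘ suc)               ≈⟨ +-congˡ (Σ-upTo-∷ʳ K (f ∘ suc)) ⟩
    f 0 + (Σ (upTo K) (f ∘ suc) + f (suc K))       ≈⟨ +-assoc _ _ _ ⟨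
    (f 0 + Σ (upTo K) (f ∘ suc)) + f (suc K)       ≈⟨ +-congʳ (Σ-upTo-suc K f) ⟨
    Σ (upTo (suc K)) f + f (suc K)                 ∎

  Σ-upTo-cong : ∀ K {f g : ℕ → Carrier} → (∀ r → r < K → f r ≈ g r) → Σ (upTo K) f ≈ Σ (upTo K) g
  Σ-upTo-cong zero    f≈g = refl
  Σ-upTo-cong (suc K) {f} {g} f≈g = begin
    Σ (upTo (suc K)) f   ≈⟨ Σ-upTo-∷ʳ K f ⟩
    Σ (upTo K) f + f K   ≈⟨ +-cong (Σ-upTo-cong K (λ r → f≈g r ∘ ℕP.m<n⇒m<1+n)) (f≈g K ℕP.≤-refl) ⟩
    Σ (upTo K) g + g K   ≈⟨ Σ-upTo-∷ʳ K g ⟨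
    Σ (upTo (suc K)) g   ∎


  Σ-upTo-≈0 : ∀ K {f : ℕ → Carrier} → (∀ r → r < K → f r ≈ 0#) → Σ (upTo K) f ≈ 0#
  Σ-upTo-≈0 K f≈0 = trans (Σ-upTo-cong K f≈0) (Σ-≈0 (upTo K) (λ _ → refl))

  Σ-upTo-+ : ∀ k K (f : ℕ → Carrier) → Σ (upTo (k ℕ.+ K)) f ≈ Σ (upTo k) f + Σ (upTo K) (λ r → f (k ℕ.+ r))
  Σ-upTo-+ k zero    f rewrite ℕP.+-identityʳ k = sym (+-identityʳ _)
  Σ-upTo-+ k (suc K) f rewrite ℕP.+-suc k K = begin
    Σ (upTo (suc (k ℕ.+ K))) f                           ≈⟨ Σ-upTo-∷ʳ (k ℕ.+ K) f ⟩
    Σ (upTo (k ℕ.+ K)) f + f (k ℕ.+ K)                   ≈⟨ +-congʳ (Σ-upTo-+ k K f) ⟩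
    (Σ (upTo k) f + Σ (upTo K) fₖ) + f (k ℕ.+ K)         ≈⟨ +-assoc _ _ _ ⟩
    Σ (upTo k) f + (Σ (upTo K) fₖ + f (k ℕ.+ K))         ≈⟨ +-congˡ (Σ-upTo-∷ʳ K fₖ) ⟨
    Σ (upTo k) f + Σ (upTo (suc K)) fₖ                   ∎
    where
    fₖ : ℕ → Carrier
    fₖ r = f (k ℕ.+ r)

  Σ-upTo-window : ∀ K i m (f : ℕ → Carrier) → i ℕ.+ m < K →
                  (∀ j → j < i → f j ≈ 0#) → (∀ j → i ℕ.+ m < j → f j ≈ 0#) →
                  Σ (upTo K) f ≈ Σ (upTo (suc m)) (λ r → f (i ℕ.+ r))
  Σ-upTo-window K i m f i+m<K below above = begin
    Σ (upTo K) f
      ≡⟨ ≡.cong (λ z → Σ (upTo z) f) i+[1+m+t]≡K ⟨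
    Σ (upTo (i ℕ.+ (suc m ℕ.+ t))) f
      ≈⟨ Σ-upTo-+ i (suc m ℕ.+ t) f ⟩
    Σ (upTo i) f + Σ (upTo (suc m ℕ.+ t)) fᵢ
      ≈⟨ +-cong (Σ-upTo-≈0 i below) (Σ-upTo-+ (suc m) t fᵢ) ⟩
    0# + (Σ (upTo (suc m)) fᵢ + Σ (upTo t) (λ q → f (i ℕ.+ (suc m ℕ.+ q))))
      ≈⟨ +-identityˡ _ ⟩
    Σ (upTo (suc m)) fᵢ + Σ (upTo t) (λ q → f (i ℕ.+ (suc m ℕ.+ q)))
      ≈⟨ +-congˡ (Σ-upTo-≈0 t (λ q _ → above _ (ℕP.+-monoʳ-< i (s≤s (ℕP.m≤m+n m q))))) ⟩
    Σ (upTo (suc m)) fᵢ + 0#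
      ≈⟨ +-identityʳ _ ⟩
    Σ (upTo (suc m)) fᵢ ∎
    where
    fᵢ : ℕ → Carrier
    fᵢ r = f (i ℕ.+ r)
    t = K ∸ (i ℕ.+ suc m)
    i+[1+m+t]≡K : i ℕ.+ (suc m ℕ.+ t) ≡ K
    i+[1+m+t]≡K = ≡.trans (≡.sym (ℕP.+-assoc i (suc m) t))
                          (ℕP.m+[n∸m]≡n (≡.subst (ℕ._≤ K) (≡.sym (ℕP.+-suc i m)) i+m<K))

  Σ-upTo-single : ∀ K k (f : ℕ → Carrier) → k < K → (∀ l → l ≢ k → f l ≈ 0#) → Σ (upTo K) f ≈ f k
  Σ-upTo-single K k f k<K others≈0 = begin
    Σ (upTo K) f          ≈⟨ Σ-upTo-window K k 0 f k+0<K below above ⟩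
    f (k ℕ.+ 0) + 0#      ≈⟨ +-identityʳ _ ⟩
    f (k ℕ.+ 0)           ≡⟨ ≡.cong f (ℕP.+-identityʳ k) ⟩
    f k                   ∎
    where
    k+0<K = ≡.subst (_< K) (≡.sym (ℕP.+-identityʳ k)) k<K
    below = λ l l<k → others≈0 l (ℕP.<⇒≢ l<k)
    above = λ l k+0<l → others≈0 l (ℕP.>⇒≢ (≡.subst (_< l) (ℕP.+-identityʳ k) k+0<l))

  -- Sums over the symmetric group

  Σ-allFin-suc : ∀ m (f : Fin (suc m) → Carrier) → Σ (allFin (suc m)) f ≈ f zero + Σ (allFin m) (f ∘ suc)
  Σ-allFin-suc m f = +-congˡ (trans (reflexive (≡.cong (λ xs → Σ xs f) tabulate-suc)) (Σ-map (allFin m) suc f))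
    where tabulate-suc = ≡.sym (ListP.map-tabulate (λ i → i) suc)

  Σ-allFin-unique : ∀ m (j : Fin m) x → Σ (allFin m) (λ i → guard (does (i FinP.≟ j)) x) ≈ x
  Σ-allFin-unique (suc m) zero x =
    trans (Σ-allFin-suc m _) (trans (+-congˡ (Σ-≈0 (allFin m) (λ _ → refl))) (+-identityʳ x))
  Σ-allFin-unique (suc m) (suc j) x =
    trans (Σ-allFin-suc m _) (trans (+-identityˡ _) (Σ-allFin-unique m j x))

  Σ-allFin-count : ∀ m (X Y : Subset m) p q x →
    Σ (allFin m) (λ i → guard (does (lookup X i Bool.≟ p) ∧ does (lookup Y i Bool.≟ q)) x) ≈ ι (count p q X Y) * x
  Σ-allFin-count zero    []       []       p q x = sym (zeroˡ x)
  Σ-allFin-count (suc m) (x₀ ∷ X) (y₀ ∷ Y) p q x = begin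
    Σ (allFin (suc m)) (λ i → guard (here i) x)
      ≈⟨ Σ-allFin-suc m _ ⟩
    guard (here zero) x + Σ (allFin m) (λ i → guard (here (suc i)) x)
      ≈⟨ +-cong (guard≈ι* (here zero) x) (Σ-allFin-count m X Y p q x) ⟩
    ι (fromBool (here zero)) * x + ι (count p q X Y) * x
      ≈⟨ distribʳ x _ _ ⟨
    (ι (fromBool (here zero)) + ι (count p q X Y)) * x
      ≈⟨ *-congʳ (ι-+ (fromBool (here zero)) (count p q X Y)) ⟨
    ι (count p q (x₀ ∷ X) (y₀ ∷ Y)) * x ∎
    where
    here : Fin (suc m) → Bool
    here i = does (lookup (x₀ ∷ X) i Bool.≟ p) ∧ does (lookup (y₀ ∷ Y) i Bool.≟ q)

  Σ-allPerms-unique : ∀ n (v : Perm n) x → Σ (allPerms n) (λ u → guard (does (u ≈ₚ? v)) x) ≈ x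
  Σ-allPerms-unique zero    v x = +-identityʳ x
  Σ-allPerms-unique (suc n) v x = begin
    Σ (allPerms (suc n)) (λ u → guard (does (u ≈ₚ? v)) x)
      ≈⟨ Σ-concatMap (allFin (suc n)) (λ i → map (insert zero i) (allPerms n)) _ ⟩
    Σ (allFin (suc n)) (λ i → Σ (map (insert zero i) (allPerms n)) (λ u → guard (does (u ≈ₚ? v)) x))
      ≈⟨ Σ-cong (allFin (suc n)) (λ i →
           trans (Σ-map (allPerms n) (insert zero i) _) (first i (i FinP.≟ v ⟨$⟩ʳ zero))) ⟩
    Σ (allFin (suc n)) (λ i → guard (does (i FinP.≟ v ⟨$⟩ʳ zero)) x)
      ≈⟨ Σ-allFin-unique (suc n) _ x ⟩
    x ∎
    where
    first : ∀ i (i≟v₀ : Dec (i ≡ v ⟨$⟩ʳ zero)) →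
            Σ (allPerms n) (λ π → guard (does (insert zero i π ≈ₚ? v)) x) ≈ guard (does i≟v₀) x
    first i (yes i≡v₀) = begin
      Σ (allPerms n) (λ π → guard (does (insert zero i π ≈ₚ? v)) x)
        ≈⟨ Σ-cong (allPerms n) (λ π → reflexive (≡.cong (λ b → guard b x)
             (does-⇔ (insert-≈ₚ π v i≡v₀) (insert zero i π ≈ₚ? v) (π ≈ₚ? remove zero v)))) ⟩
      Σ (allPerms n) (λ π → guard (does (π ≈ₚ? remove zero v)) x)
        ≈⟨ Σ-allPerms-unique n (remove zero v) x ⟩
      x ∎
    first i (no i≢v₀) = Σ-≈0 (allPerms n) (λ π → reflexive (≡.cong (λ b → guard b x)
                          (dec-false (insert zero i π ≈ₚ? v) (λ e → i≢v₀ (e zero)))))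

  -- Pointwise equal permutations need not be equal, so the elements of 𝒜 n we use must respect ≈ₚ.
  Congruent : ∀ {n} → 𝒜 n → Set ℓ
  Congruent {n} f = ∀ (u v : Perm n) → u ≈ₚ v → f u ≈ f v

  Σ-allPerms-pick : ∀ n (v : Perm n) (g : 𝒜 n) → Congruent g →
                    Σ (allPerms n) (λ u → guard (does (u ≈ₚ? v)) (g u)) ≈ g v
  Σ-allPerms-pick n v g g-cong =
    trans (Σ-cong (allPerms n) (λ u → guard-cong (u ≈ₚ? v) (g-cong u v))) (Σ-allPerms-unique n v (g v))

  Σ-allPerms-translate : ∀ n (v : Perm n) (φ : 𝒜 n) → Congruent φ →
                         Σ (allPerms n) (λ u → φ (v ·ₚ u)) ≈ Σ (allPerms n) φ
  Σ-allPerms-translate n v φ φ-cong = begin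
    Σ (allPerms n) (λ u → φ (v ·ₚ u))
      ≈⟨ Σ-cong (allPerms n) (λ u → Σ-allPerms-pick n (v ·ₚ u) φ φ-cong) ⟨
    Σ (allPerms n) (λ u → Σ (allPerms n) (λ u′ → guard (does (u′ ≈ₚ? v ·ₚ u)) (φ u′)))
      ≈⟨ Σ-comm (allPerms n) (allPerms n) _ ⟩
    Σ (allPerms n) (λ u′ → Σ (allPerms n) (λ u → guard (does (u′ ≈ₚ? v ·ₚ u)) (φ u′)))
      ≈⟨ Σ-cong (allPerms n) (λ u′ → Σ-cong (allPerms n) (λ u → reflexive (≡.cong (λ b → guard b (φ u′))
           (does-⇔ (solve-for u u′) (u′ ≈ₚ? v ·ₚ u) (u ≈ₚ? flip v ·ₚ u′))))) ⟩
    Σ (allPerms n) (λ u′ → Σ (allPerms n) (λ u → guard (does (u ≈ₚ? flip v ·ₚ u′)) (φ u′)))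
      ≈⟨ Σ-cong (allPerms n) (λ u′ → Σ-allPerms-unique n (flip v ·ₚ u′) (φ u′)) ⟩
    Σ (allPerms n) φ ∎
    where
    solve-for : ∀ u u′ → u′ ≈ₚ v ·ₚ u ⇔ u ≈ₚ flip v ·ₚ u′
    solve-for u u′ = mk⇔ (λ e i → ≡.trans (≡.sym (inverseˡ v)) (≡.cong (v ⟨$⟩ˡ_) (≡.sym (e i))))
                         (λ e i → ≡.trans (≡.sym (inverseʳ v)) (≡.cong (v ⟨$⟩ʳ_) (≡.sym (e i))))

  -- When nonempty, the permutations taking (X, Y) to (X′, Y′) form a coset of the stabiliser of (X, Y),
  -- which has ω′ X Y elements.
  Σ-transporter : ∀ n (X Y X′ Y′ : Subset n) →
    Σ (allPerms n) (λ u → guard (subsetEq (image u X) X′) (guard (subsetEq (image u Y) Y′) 1#))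
    ≈ guard (does (sameType? X Y X′ Y′)) (ι (ω′ X Y))
  Σ-transporter zero    []      []      []  []  = trans (+-identityʳ _) (sym ι-1)
  Σ-transporter (suc n) (x ∷ X) (y ∷ Y) X′ Y′ = begin
    Σ (allPerms (suc n)) F
      ≈⟨ Σ-concatMap (allFin (suc n)) (λ i → map (insert zero i) (allPerms n)) F ⟩
    Σ (allFin (suc n)) (λ i → Σ (map (insert zero i) (allPerms n)) F)
      ≈⟨ Σ-cong (allFin (suc n)) (λ i → trans (Σ-map (allPerms n) (insert zero i) F) (fixing i)) ⟩
    Σ (allFin (suc n)) (λ i → guard (matches i) (guard sameType (ι (ω′ X Y))))
      ≈⟨ Σ-allFin-count (suc n) X′ Y′ x y _ ⟩
    ι (count x y X′ Y′) * guard sameType (ι (ω′ X Y))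
      ≈⟨ guard-*ˡ sameType _ _ ⟩
    guard sameType (ι (count x y X′ Y′) * ι (ω′ X Y))
      ≈⟨ guard-cong (sameType? (x ∷ X) (y ∷ Y) X′ Y′) (λ t →
           trans (sym (ι-* (count x y X′ Y′) (ω′ X Y))) (reflexive (≡.cong ι (ω′-split t)))) ⟩
    guard sameType (ι (ω′ (x ∷ X) (y ∷ Y))) ∎
    where
    F : Perm (suc n) → Carrier
    F u = guard (subsetEq (image u (x ∷ X)) X′) (guard (subsetEq (image u (y ∷ Y)) Y′) 1#)
    sameType : Bool
    sameType = does (sameType? (x ∷ X) (y ∷ Y) X′ Y′)
    matches : Fin (suc n) → Bool
    matches i = does (lookup X′ i Bool.≟ x) ∧ does (lookup Y′ i Bool.≟ y)
    F-rest : Fin (suc n) → Perm n → Carrier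
    F-rest i π = guard (subsetEq (image π X) (removeAt X′ i)) (guard (subsetEq (image π Y) (removeAt Y′ i)) 1#)
    ω′-split : SameType (x ∷ X) (y ∷ Y) X′ Y′ → count x y X′ Y′ ℕ.* ω′ X Y ≡ ω′ (x ∷ X) (y ∷ Y)
    ω′-split t = ≡.trans (≡.cong (ℕ._* ω′ X Y) (≡.trans (≡.sym (t x y)) (count-∷-self x y X Y)))
                         (≡.sym (ω′-∷ x y X Y))
    fixing : ∀ i → Σ (allPerms n) (λ π → F (insert zero i π)) ≈ guard (matches i) (guard sameType (ι (ω′ X Y)))
    fixing i = begin
      Σ (allPerms n) (λ π → F (insert zero i π))
        ≈⟨ Σ-cong (allPerms n) (λ π → reflexive (≡.trans
             (≡.cong₂ (λ s t → guard s (guard t 1#)) (subsetEq-insert i π x X X′) (subsetEq-insert i π y Y Y′))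
             (guard-interchange (does (lookup X′ i Bool.≟ x)) (subsetEq (image π X) (removeAt X′ i))
                                (does (lookup Y′ i Bool.≟ y)) (subsetEq (image π Y) (removeAt Y′ i)) 1#))) ⟩
      Σ (allPerms n) (λ π → guard (matches i) (F-rest i π))
        ≈⟨ Σ-guard (allPerms n) (matches i) (F-rest i) ⟩
      guard (matches i) (Σ (allPerms n) (F-rest i))
        ≈⟨ guard-cong ((lookup X′ i Bool.≟ x) ×-dec (lookup Y′ i Bool.≟ y)) (λ (X′ᵢ≡x , Y′ᵢ≡y) →
             trans (Σ-transporter n X Y (removeAt X′ i) (removeAt Y′ i))
                   (reflexive (≡.cong (λ b → guard b (ι (ω′ X Y)))
                     (does-⇔ (sameType-removeAt x y X Y X′ Y′ i X′ᵢ≡x Y′ᵢ≡y)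
                             (sameType? X Y (removeAt X′ i) (removeAt Y′ i)) (sameType? (x ∷ X) (y ∷ Y) X′ Y′))))) ⟩
      guard (matches i) (guard sameType (ι (ω′ X Y))) ∎


  -- The group algebra

  *ᴬ-congʳ : ∀ {n} (f : 𝒜 n) {g g′ : 𝒜 n} → g ≈ᴬ g′ → (f *ᴬ g) ≈ᴬ (f *ᴬ g′)
  *ᴬ-congʳ {n} f g≈g′ w = Σ-cong (allPerms n) (λ u → *-congˡ (g≈g′ _))

  *ᴬ-congruent : ∀ {n} (f g : 𝒜 n) → Congruent g → Congruent (f *ᴬ g)
  *ᴬ-congruent {n} f g g-cong v v′ v≈v′ =
    Σ-cong (allPerms n) (λ u → *-congˡ (g-cong _ _ (λ i → ≡.cong (u ⟨$⟩ˡ_) (v≈v′ i))))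

  scalar-congruent : ∀ {n} s → Congruent {n} (scalar s)
  scalar-congruent s u v u≈v =
    reflexive (≡.cong (λ b → guard b s) (does-⇔ u≈id⇔v≈id (u ≈ₚ? id) (v ≈ₚ? id)))
    where u≈id⇔v≈id = mk⇔ (λ e i → ≡.trans (≡.sym (u≈v i)) (e i)) (λ e i → ≡.trans (u≈v i) (e i))

  scalar-*ᴬ : ∀ {n} s (h : 𝒜 n) → Congruent h → ∀ w → (scalar s *ᴬ h) w ≈ s * h w
  scalar-*ᴬ {n} s h h-cong w = begin
    Σ (allPerms n) (λ u → scalar s u * h (flip u ·ₚ w))
      ≈⟨ Σ-cong (allPerms n) (λ u → guard-*ʳ (isId u) s _) ⟩
    Σ (allPerms n) (λ u → guard (isId u) (s * h (flip u ·ₚ w)))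
      ≈⟨ Σ-allPerms-pick n id (λ u → s * h (flip u ·ₚ w)) s*h-cong ⟩
    s * h (flip id ·ₚ w)
      ≈⟨ *-congˡ (h-cong _ _ (λ i → ≡.refl)) ⟩
    s * h w ∎
    where
    s*h-cong : Congruent (λ u → s * h (flip u ·ₚ w))
    s*h-cong u v u≈v = *-congˡ (h-cong _ _ (λ i → ⟨$⟩ˡ-cong u v u≈v (w ⟨$⟩ʳ i)))

  -ᴬ-*ᴬ : ∀ {n} (f g h : 𝒜 n) w → ((f -ᴬ g) *ᴬ h) w ≈ (f *ᴬ h) w - (g *ᴬ h) w
  -ᴬ-*ᴬ {n} f g h w = trans
    (Σ-cong (allPerms n) (λ u → trans (distribʳ _ _ _) (+-congˡ (sym (-‿distribˡ-* _ _)))))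
    (Σ-distrib-- (allPerms n) (λ u → f u * h (flip u ·ₚ w)) (λ u → g u * h (flip u ·ₚ w)))

  *ᴬ-assoc : ∀ {n} (f g h : 𝒜 n) → Congruent g → Congruent h → ((f *ᴬ g) *ᴬ h) ≈ᴬ (f *ᴬ (g *ᴬ h))
  *ᴬ-assoc {n} f g h g-cong h-cong w = begin
    Σ (allPerms n) (λ u → Σ (allPerms n) (λ v → f v * g (flip v ·ₚ u)) * h (flip u ·ₚ w))
      ≈⟨ Σ-cong (allPerms n) (λ u → *-distribʳ-Σ (allPerms n) _ _) ⟩
    Σ (allPerms n) (λ u → Σ (allPerms n) (λ v → f v * g (flip v ·ₚ u) * h (flip u ·ₚ w)))
      ≈⟨ Σ-comm (allPerms n) (allPerms n) _ ⟩
    Σ (allPerms n) (λ v → Σ (allPerms n) (λ u → f v * g (flip v ·ₚ u) * h (flip u ·ₚ w)))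
      ≈⟨ Σ-cong (allPerms n) (λ v →
           trans (Σ-cong (allPerms n) (λ u → *-assoc _ _ _)) (sym (*-distribˡ-Σ (allPerms n) (f v) _))) ⟩
    Σ (allPerms n) (λ v → f v * Σ (allPerms n) (λ u → g (flip v ·ₚ u) * h (flip u ·ₚ w)))
      ≈⟨ Σ-cong (allPerms n) (λ v → *-congˡ (translated v)) ⟩
    Σ (allPerms n) (λ v → f v * Σ (allPerms n) (λ u → g u * h (flip u ·ₚ (flip v ·ₚ w)))) ∎
    where
    translated : ∀ v → Σ (allPerms n) (λ u → g (flip v ·ₚ u) * h (flip u ·ₚ w))
                     ≈ Σ (allPerms n) (λ u → g u * h (flip u ·ₚ (flip v ·ₚ w)))
    translated v = begin
      Σ (allPerms n) φ
        ≈⟨ Σ-allPerms-translate n v φ φ-cong ⟨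
      Σ (allPerms n) (λ u → φ (v ·ₚ u))
        ≈⟨ Σ-cong (allPerms n) (λ u → *-cong (g-cong _ _ (λ i → inverseˡ v)) (h-cong _ _ (λ i → ≡.refl))) ⟩
      Σ (allPerms n) (λ u → g u * h (flip u ·ₚ (flip v ·ₚ w))) ∎
      where
      φ : 𝒜 n
      φ u = g (flip v ·ₚ u) * h (flip u ·ₚ w)
      φ-cong : Congruent φ
      φ-cong u u′ u≈u′ = *-cong (g-cong _ _ (λ i → ≡.cong (v ⟨$⟩ˡ_) (u≈u′ i)))
                                (h-cong _ _ (λ i → ⟨$⟩ˡ-cong u u′ u≈u′ (w ⟨$⟩ʳ i)))

  ∏ᴬ-congruent : ∀ {n} (ks : List ℕ) (F : ℕ → 𝒜 n) → Congruent (∏ᴬ ks F)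
  ∏ᴬ-congruent []       F = scalar-congruent 1#
  ∏ᴬ-congruent (k ∷ ks) F = *ᴬ-congruent (F k) _ (∏ᴬ-congruent ks F)

  ∏ᴬ-*ᴬ : ∀ {n} (ks : List ℕ) (F : ℕ → 𝒜 n) (y : 𝒜 n) → Congruent y →
          (∏ᴬ ks F *ᴬ y) ≈ᴬ foldr (λ k acc → F k *ᴬ acc) y ks
  ∏ᴬ-*ᴬ []       F y y-cong w = trans (scalar-*ᴬ 1# y y-cong w) (*-identityˡ _)
  ∏ᴬ-*ᴬ (k ∷ ks) F y y-cong w = trans (*ᴬ-assoc (F k) (∏ᴬ ks F) y (∏ᴬ-congruent ks F) y-cong w)
                                      (*ᴬ-congʳ (F k) (∏ᴬ-*ᴬ ks F y y-cong) w)

  ∇-congruent : ∀ {n} (Y X : Subset n) → Congruent (∇ Y X)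
  ∇-congruent Y X u v u≈v = reflexive (≡.cong (λ Z → guard (subsetEq Z Y) 1#) (image-cong u v X u≈v))

  ∇α-congruent : ∀ {n} (D : Subset n) α → Congruent (∇α D α)
  ∇α-congruent D α u v u≈v = Σ-cong (sameSize D) (λ X → *-congˡ (∇-congruent D X u v u≈v))

  -- Sums over subsets

  Σ-allSubsets-suc : ∀ n (f : Subset (suc n) → Carrier) →
    Σ (allSubsets (suc n)) f ≈ Σ (allSubsets n) (λ E → f (inside ∷ E)) + Σ (allSubsets n) (λ E → f (outside ∷ E))
  Σ-allSubsets-suc n f = trans (Σ-++ (map (inside ∷_) (allSubsets n)) _ f)
                               (+-cong (Σ-map (allSubsets n) (inside ∷_) f) (Σ-map (allSubsets n) (outside ∷_) f))

  Σ-allSubsets-unique : ∀ n (Z : Subset n) (g : Subset n → Carrier) →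
                        Σ (allSubsets n) (λ E → guard (subsetEq Z E) (g E)) ≈ g Z
  Σ-allSubsets-unique zero    []            g = +-identityʳ _
  Σ-allSubsets-unique (suc n) (inside ∷ Z)  g = trans (Σ-allSubsets-suc n _)
    (trans (+-congˡ (Σ-≈0 (allSubsets n) (λ _ → refl))) (trans (+-identityʳ _) (Σ-allSubsets-unique n Z _)))
  Σ-allSubsets-unique (suc n) (outside ∷ Z) g = trans (Σ-allSubsets-suc n _)
    (+-cong-0ˡ (Σ-≈0 (allSubsets n) (λ _ → refl)) (Σ-allSubsets-unique n Z _))

  Σ-sameSize-cong : ∀ {n} (D : Subset n) {f g : Subset n → Carrier} →
                    (∀ X → ∣ X ∣ ≡ ∣ D ∣ → f X ≈ g X) → Σ (sameSize D) f ≈ Σ (sameSize D) g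
  Σ-sameSize-cong {n} D {f} {g} f≈g = begin
    Σ (sameSize D) f                                       ≈⟨ Σ-filter ofSize (allSubsets n) f ⟩
    Σ (allSubsets n) (λ X → guard (does (ofSize X)) (f X)) ≈⟨ Σ-cong (allSubsets n) (λ X → guard-cong (ofSize X) (f≈g X)) ⟩
    Σ (allSubsets n) (λ X → guard (does (ofSize X)) (g X)) ≈⟨ Σ-filter ofSize (allSubsets n) g ⟨
    Σ (sameSize D) g                                       ∎
    where
    ofSize : ∀ X → Dec (∣ X ∣ ≡ ∣ D ∣)
    ofSize X = ∣ X ∣ ℕ.≟ ∣ D ∣

  Σ-subsets-avoiding : ∀ n (D Z : Subset n) k →
    Σ (allSubsets n) (λ B → guard (does (B ⊆? D)) (guard (does (∣ B ∣ ℕ.≟ k)) (guard (disjoint B Z) 1#)))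
    ≈ ι (count inside outside D Z C k)
  Σ-subsets-avoiding zero    []            []            zero    = trans (+-identityʳ _) (sym ι-1)
  Σ-subsets-avoiding zero    []            []            (suc k) = +-identityʳ _
  Σ-subsets-avoiding (suc n) (outside ∷ D) (z ∷ Z)       k       = trans (Σ-allSubsets-suc n _)
    (+-cong-0ˡ (Σ-≈0 (allSubsets n) (λ _ → refl)) (Σ-subsets-avoiding n D Z k))
  Σ-subsets-avoiding (suc n) (inside ∷ D)  (inside ∷ Z)  k       = trans (Σ-allSubsets-suc n _)
    (+-cong-0ˡ (Σ-≈0 (allSubsets n) (λ B → guard-≈0 (does (B ⊆? D)) (guard-0# (does (suc ∣ B ∣ ℕ.≟ k)))))
               (Σ-subsets-avoiding n D Z k))
  Σ-subsets-avoiding (suc n) (inside ∷ D)  (outside ∷ Z) zero    = trans (Σ-allSubsets-suc n _)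
    (+-cong-0ˡ (Σ-≈0 (allSubsets n) (λ B → guard-0# (does (B ⊆? D)))) (Σ-subsets-avoiding n D Z zero))
  Σ-subsets-avoiding (suc n) (inside ∷ D)  (outside ∷ Z) (suc k) = trans (Σ-allSubsets-suc n _)
    (trans (+-cong (Σ-subsets-avoiding n D Z k) (Σ-subsets-avoiding n D Z (suc k)))
           (sym (ι-pascal (count inside outside D Z) k)))

  Σ-subsets-of-type : ∀ n (D W : Subset n) a b →
    Σ (allSubsets n) (λ E → guard (does (a ℕ.≟ count inside inside D E) ∧ does (b ℕ.≟ count outside inside D E))
                                  (guard (disjoint E W) 1#))
    ≈ ι (count inside outside D W C a) * ι (count outside outside D W C b)
  Σ-subsets-of-type zero    []            []            zero    zero    =
    trans (+-identityʳ _) (sym (trans (*-cong ι-1 ι-1) (*-identityˡ _)))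
  Σ-subsets-of-type zero    []            []            zero    (suc b) = trans (+-identityʳ _) (sym (zeroʳ _))
  Σ-subsets-of-type zero    []            []            (suc a) b       = trans (+-identityʳ _) (sym (zeroˡ _))
  Σ-subsets-of-type (suc n) (inside ∷ D)  (inside ∷ W)  a       b       = trans (Σ-allSubsets-suc n _)
    (+-cong-0ˡ (Σ-≈0 (allSubsets n) (λ _ → guard-0# _)) (Σ-subsets-of-type n D W a b))
  Σ-subsets-of-type (suc n) (outside ∷ D) (inside ∷ W)  a       b       = trans (Σ-allSubsets-suc n _)
    (+-cong-0ˡ (Σ-≈0 (allSubsets n) (λ _ → guard-0# _)) (Σ-subsets-of-type n D W a b))
  Σ-subsets-of-type (suc n) (inside ∷ D)  (outside ∷ W) zero    b       = trans (Σ-allSubsets-suc n _)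
    (+-cong-0ˡ (Σ-≈0 (allSubsets n) (λ _ → refl)) (Σ-subsets-of-type n D W zero b))
  Σ-subsets-of-type (suc n) (inside ∷ D)  (outside ∷ W) (suc a) b       = trans (Σ-allSubsets-suc n _)
    (trans (+-cong (Σ-subsets-of-type n D W a b) (Σ-subsets-of-type n D W (suc a) b))
           (trans (sym (distribʳ _ _ _)) (*-congʳ (sym (ι-pascal (count inside outside D W) a)))))
  Σ-subsets-of-type (suc n) (outside ∷ D) (outside ∷ W) a       zero    = trans (Σ-allSubsets-suc n _)
    (+-cong-0ˡ (Σ-≈0 (allSubsets n) (λ E → reflexive (≡.cong (λ t → guard t (guard (disjoint E W) 1#))
                                                      (∧-zeroʳ (does (a ℕ.≟ count inside inside D E))))))
               (Σ-subsets-of-type n D W a zero))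
  Σ-subsets-of-type (suc n) (outside ∷ D) (outside ∷ W) a       (suc b) = trans (Σ-allSubsets-suc n _)
    (trans (+-cong (Σ-subsets-of-type n D W a b) (Σ-subsets-of-type n D W a (suc b)))
           (trans (sym (distribˡ _ _ _)) (*-congˡ (sym (ι-pascal (count outside outside D W) b)))))

  Σ-∇-disjoint : ∀ n (D X B W : Subset n) → ∣ X ∣ ≡ ∣ D ∣ →
    Σ (allPerms n) (λ u → ∇ D X u * guard (disjoint (image u B) W) 1#)
    ≈ ι (ω′ X B) * (ι (count inside outside D W C count inside inside X B)
                    * ι (count outside outside D W C count outside inside X B))
  Σ-∇-disjoint n D X B W ∣X∣≡∣D∣ = begin
    Σ (allPerms n) (λ u → ∇ D X u * guard (disjoint (image u B) W) 1#)
      ≈⟨ Σ-cong (allPerms n) (λ u → *-congˡ (Σ-allSubsets-unique n (image u B) disjointFrom)) ⟨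
    Σ (allPerms n) (λ u → ∇ D X u * Σ (allSubsets n) (λ E → guard (subsetEq (image u B) E) (disjointFrom E)))
      ≈⟨ Σ-cong (allPerms n) (λ u → trans (*-distribˡ-Σ (allSubsets n) _ _)
           (Σ-cong (allSubsets n) (λ E → guard-1#-* (subsetEq (image u X) D) (subsetEq (image u B) E) _))) ⟩
    Σ (allPerms n) (λ u → Σ (allSubsets n) (λ E → disjointFrom E * transports u E))
      ≈⟨ Σ-comm (allPerms n) (allSubsets n) _ ⟩
    Σ (allSubsets n) (λ E → Σ (allPerms n) (λ u → disjointFrom E * transports u E))
      ≈⟨ Σ-cong (allSubsets n) (λ E →
           trans (sym (*-distribˡ-Σ (allPerms n) _ _)) (*-congˡ (Σ-transporter n X B D E))) ⟩
    Σ (allSubsets n) (λ E → disjointFrom E * guard (does (sameType? X B D E)) (ι (ω′ X B)))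
      ≈⟨ Σ-cong (allSubsets n) (λ E → trans (guard-1#-* (disjoint E W) _ _)
           (*-congˡ (reflexive (guard-comm (disjoint E W) (does (sameType? X B D E)) 1#)))) ⟩
    Σ (allSubsets n) (λ E → ι (ω′ X B) * guard (does (sameType? X B D E)) (disjointFrom E))
      ≈⟨ *-distribˡ-Σ (allSubsets n) _ _ ⟨
    ι (ω′ X B) * Σ (allSubsets n) (λ E → guard (does (sameType? X B D E)) (disjointFrom E))
      ≈⟨ *-congˡ (Σ-cong (allSubsets n) (λ E → reflexive (≡.cong (λ b → guard b (disjointFrom E))
           (does-⇔ (sameType⇔ X B D E ∣X∣≡∣D∣) (sameType? X B D E) (_ ℕ.≟ _ ×-dec _ ℕ.≟ _))))) ⟩
    ι (ω′ X B) * Σ (allSubsets n) (λ E → guard (does (count inside inside X B ℕ.≟ count inside inside D E)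
                                                 ∧ does (count outside inside X B ℕ.≟ count outside inside D E))
                                                (disjointFrom E))
      ≈⟨ *-congˡ (Σ-subsets-of-type n D W (count inside inside X B) (count outside inside X B)) ⟩
    ι (ω′ X B) * (ι (count inside outside D W C count inside inside X B)
                  * ι (count outside outside D W C count outside inside X B)) ∎
    where
    disjointFrom : Subset n → Carrier
    disjointFrom E = guard (disjoint E W) 1#
    transports : Perm n → Subset n → Carrier
    transports u E = guard (subsetEq (image u X) D) (guard (subsetEq (image u B) E) 1#)

  Σ-∇-avoiding : ∀ n (D X W : Subset n) k → ∣ X ∣ ≡ ∣ D ∣ →
    Σ (allPerms n) (λ u → ∇ D X u * ι (count inside outside D (image (flip u) W) C k))
    ≈ Σ (allSubsets n) (λ B → guard (does (B ⊆? D)) (guard (does (∣ B ∣ ℕ.≟ k))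
        (ι (ω′ X B) * (ι (count inside outside D W C count inside inside X B)
                       * ι (count outside outside D W C count outside inside X B)))))
  Σ-∇-avoiding n D X W k ∣X∣≡∣D∣ = begin
    Σ (allPerms n) (λ u → ∇ D X u * ι (count inside outside D (image (flip u) W) C k))
      ≈⟨ Σ-cong (allPerms n) (λ u → *-congˡ (Σ-subsets-avoiding n D (image (flip u) W) k)) ⟨
    Σ (allPerms n) (λ u → ∇ D X u * Σ (allSubsets n) (λ B → chosen B (guard (disjoint B (image (flip u) W)) 1#)))
      ≈⟨ Σ-cong (allPerms n) (λ u → trans (*-distribˡ-Σ (allSubsets n) _ _) (Σ-cong (allSubsets n) (pushed u))) ⟩
    Σ (allPerms n) (λ u → Σ (allSubsets n) (λ B → chosen B (∇ D X u * guard (disjoint (image u B) W) 1#)))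
      ≈⟨ Σ-comm (allPerms n) (allSubsets n) _ ⟩
    Σ (allSubsets n) (λ B → Σ (allPerms n) (λ u → chosen B (∇ D X u * guard (disjoint (image u B) W) 1#)))
      ≈⟨ Σ-cong (allSubsets n) (λ B →
           trans (Σ-guard (allPerms n) (does (B ⊆? D)) _) (guard-cong (B ⊆? D) (λ _ →
           trans (Σ-guard (allPerms n) (does (∣ B ∣ ℕ.≟ k)) _) (guard-cong (∣ B ∣ ℕ.≟ k) (λ _ →
           Σ-∇-disjoint n D X B W ∣X∣≡∣D∣))))) ⟩
    Σ (allSubsets n) (λ B → chosen B
        (ι (ω′ X B) * (ι (count inside outside D W C count inside inside X B)
                       * ι (count outside outside D W C count outside inside X B)))) ∎
    where
    chosen : Subset n → Carrier → Carrier
    chosen B x = guard (does (B ⊆? D)) (guard (does (∣ B ∣ ℕ.≟ k)) x)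
    pushed : ∀ u B → ∇ D X u * chosen B (guard (disjoint B (image (flip u) W)) 1#)
                   ≈ chosen B (∇ D X u * guard (disjoint (image u B) W) 1#)
    pushed u B = begin
      ∇ D X u * chosen B (guard (disjoint B (image (flip u) W)) 1#)
        ≈⟨ guard-*ˡ (does (B ⊆? D)) _ _ ⟩
      guard (does (B ⊆? D)) (∇ D X u * guard (does (∣ B ∣ ℕ.≟ k)) _)
        ≈⟨ guard-cong (B ⊆? D) (λ _ → guard-*ˡ (does (∣ B ∣ ℕ.≟ k)) _ _) ⟩
      chosen B (∇ D X u * guard (disjoint B (image (flip u) W)) 1#)
        ≡⟨ ≡.cong (λ b → chosen B (∇ D X u * guard b 1#)) (disjoint-image u B W) ⟩
      chosen B (∇ D X u * guard (disjoint (image u B) W) 1#) ∎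

  -- Alternating binomial sums

  alternatingTerm : ℕ → ℕ → ℕ → ℕ → Carrier
  alternatingTerm s N m r = negOnePow r * ι ((s C r) ℕ.* ((N ∸ r) C (m ∸ r)))

  -- Inclusion–exclusion for the m-subsets of an N-set that avoid a fixed s-subset.
  Σ-alternatingTerm : ∀ s N m → s ≤ N → Σ (upTo (suc m)) (alternatingTerm s N m) ≈ ι ((N ∸ s) C m)
  Σ-alternatingTerm zero N m _ = begin
    Σ (upTo (suc m)) (alternatingTerm zero N m)
      ≈⟨ Σ-upTo-suc m _ ⟩
    alternatingTerm zero N m 0 + Σ (upTo m) (alternatingTerm zero N m ∘ suc)
      ≈⟨ +-congˡ (Σ-≈0 (upTo m) (λ _ → zeroʳ _)) ⟩
    alternatingTerm zero N m 0 + 0#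
      ≈⟨ trans (+-identityʳ _) (*-identityˡ _) ⟩
    ι ((N C m) ℕ.+ 0)
      ≡⟨ ≡.cong ι (ℕP.+-identityʳ (N C m)) ⟩
    ι (N C m) ∎
  Σ-alternatingTerm (suc s) (suc N) m (s≤s s≤N) = begin
    Σ (upTo (suc m)) (alternatingTerm (suc s) (suc N) m)
      ≈⟨ Σ-cong (upTo (suc m)) pascal-split ⟩
    Σ (upTo (suc m)) (λ r → alternatingTerm s (suc N) m r + g m r)
      ≈⟨ Σ-distrib-+ (upTo (suc m)) _ _ ⟩
    Σ (upTo (suc m)) (alternatingTerm s (suc N) m) + Σ (upTo (suc m)) (g m)
      ≈⟨ +-cong (Σ-alternatingTerm s (suc N) m (ℕP.m≤n⇒m≤1+n s≤N))
                (trans (Σ-upTo-suc m (g m)) (+-identityˡ _)) ⟩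
    ι ((suc N ∸ s) C m) + Σ (upTo m) (g m ∘ suc)
      ≈⟨ shifted m ⟩
    ι ((N ∸ s) C m) ∎
    where
    g : ℕ → ℕ → Carrier
    g m zero    = 0#
    g m (suc r) = - (negOnePow r * ι ((s C r) ℕ.* ((N ∸ r) C (m ∸ suc r))))
    pascal-split : ∀ r → alternatingTerm (suc s) (suc N) m r ≈ alternatingTerm s (suc N) m r + g m r
    pascal-split zero    = sym (+-identityʳ _)
    pascal-split (suc r) = begin
      negOnePow (suc r) * ι ((suc s C suc r) ℕ.* X)
        ≈⟨ *-congˡ (trans (ι-* (suc s C suc r) X) (trans (*-congʳ (ι-pascal s r)) (distribʳ _ _ _))) ⟩
      negOnePow (suc r) * (ι (s C r) * ι X + ι (s C suc r) * ι X)
        ≈⟨ trans (distribˡ _ _ _) (+-comm _ _) ⟩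
      negOnePow (suc r) * (ι (s C suc r) * ι X) + negOnePow (suc r) * (ι (s C r) * ι X)
        ≈⟨ +-cong (*-congˡ (sym (ι-* (s C suc r) X)))
                  (trans (sym (-‿distribˡ-* _ _)) (-‿cong (*-congˡ (sym (ι-* (s C r) X))))) ⟩
      alternatingTerm s (suc N) m (suc r) + g m (suc r) ∎
      where X = (N ∸ r) C (m ∸ suc r)
    shifted : ∀ m → ι ((suc N ∸ s) C m) + Σ (upTo m) (g m ∘ suc) ≈ ι ((N ∸ s) C m)
    shifted zero     = +-identityʳ _
    shifted (suc m′) = begin
      ι ((suc N ∸ s) C suc m′) + Σ (upTo (suc m′)) (λ r → - alternatingTerm s N m′ r)
        ≈⟨ +-cong (reflexive (≡.cong (λ z → ι (z C suc m′)) (ℕP.+-∸-assoc 1 s≤N)))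
                  (sym (-‿distrib-Σ (upTo (suc m′)) _)) ⟩
      ι (suc (N ∸ s) C suc m′) + - Σ (upTo (suc m′)) (alternatingTerm s N m′)
        ≈⟨ +-cong (ι-pascal (N ∸ s) m′) (-‿cong (Σ-alternatingTerm s N m′ s≤N)) ⟩
      (ι ((N ∸ s) C m′) + ι ((N ∸ s) C suc m′)) - ι ((N ∸ s) C m′)
        ≈⟨ trans (+-congʳ (+-comm _ _))
                 (trans (+-assoc _ _ _) (trans (+-congˡ (-‿inverseʳ _)) (+-identityʳ _))) ⟩
      ι ((N ∸ s) C suc m′) ∎

  Σ-alternating-binomial-prefix : ∀ s M →
    Σ (upTo (suc M)) (λ l → negOnePow l * ι (suc s C l)) ≈ negOnePow M * ι (s C M)
  Σ-alternating-binomial-prefix s zero    = +-identityʳ _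
  Σ-alternating-binomial-prefix s (suc M) = begin
    Σ (upTo (suc (suc M))) f          ≈⟨ Σ-upTo-∷ʳ (suc M) f ⟩
    Σ (upTo (suc M)) f + f (suc M)    ≈⟨ +-cong (Σ-alternating-binomial-prefix s M) (*-congˡ (ι-pascal s M)) ⟩
    ε * a + (- ε) * (a + b)           ≈⟨ +-congˡ (trans (sym (-‿distribˡ-* ε _)) (-‿cong (distribˡ ε a b))) ⟩
    ε * a + - (ε * a + ε * b)         ≈⟨ +-congˡ (sym (-‿+-comm _ _)) ⟩
    ε * a + (- (ε * a) + - (ε * b))   ≈⟨ +-assoc _ _ _ ⟨
    (ε * a + - (ε * a)) + - (ε * b)   ≈⟨ trans (+-congʳ (-‿inverseʳ _)) (+-identityˡ _) ⟩
    - (ε * b)                         ≈⟨ -‿distribˡ-* ε b ⟩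
    negOnePow (suc M) * ι (s C suc M) ∎
    where
    f = λ l → negOnePow l * ι (suc s C l)
    ε = negOnePow M
    a = ι (s C M)
    b = ι (s C suc M)

  Σ-alternating-binomial : ∀ s d → s ≤ d →
    Σ (upTo (suc d)) (λ l → negOnePow l * ι (s C l)) ≈ guard (does (s ℕ.≟ 0)) 1#
  Σ-alternating-binomial zero    d       _         = trans (Σ-upTo-suc d _)
    (trans (+-congˡ (Σ-≈0 (upTo d) (λ _ → zeroʳ _))) (trans (+-identityʳ _) (trans (*-identityˡ _) ι-1)))
  Σ-alternating-binomial (suc s) (suc d) (s≤s s≤d) = trans (Σ-alternating-binomial-prefix s (suc d))
    (trans (*-congˡ (reflexive (≡.cong ι (k>n⇒nCk≡0 (s≤s s≤d))))) (zeroʳ _))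

  expansionCoeff : ℕ → ℕ → ℕ → ℕ → Carrier
  expansionCoeff N i m j = guard (does (i ℕ.≤? j) ∧ does (j ℕ.≤? i ℕ.+ m))
                                 (negOnePow (j ∸ i) * ι ((j C i) ℕ.* ((N ∸ j) C (i ℕ.+ m ∸ j))))

  expansionCoeff-below : ∀ N i m j → j < i → expansionCoeff N i m j ≈ 0#
  expansionCoeff-below N i m j j<i rewrite dec-false (i ℕ.≤? j) (ℕP.<⇒≱ j<i) = refl

  expansionCoeff-above : ∀ N i m j → i ℕ.+ m < j → expansionCoeff N i m j ≈ 0#
  expansionCoeff-above N i m j i+m<j rewrite dec-false (j ℕ.≤? i ℕ.+ m) (ℕP.<⇒≱ i+m<j) =
    reflexive (≡.cong (λ b → guard b (negOnePow (j ∸ i) * ι ((j C i) ℕ.* ((N ∸ j) C (i ℕ.+ m ∸ j)))))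
                      (∧-zeroʳ (does (i ℕ.≤? j))))

  expansionCoeff-window : ∀ N i m r → r ≤ m →
    expansionCoeff N i m (i ℕ.+ r) ≈ negOnePow r * ι (((i ℕ.+ r) C i) ℕ.* ((N ∸ i ∸ r) C (m ∸ r)))
  expansionCoeff-window N i m r r≤m
    rewrite dec-true (i ℕ.≤? i ℕ.+ r) (ℕP.m≤m+n i r)
          | dec-true (i ℕ.+ r ℕ.≤? i ℕ.+ m) (ℕP.+-monoʳ-≤ i r≤m)
          | ℕP.m+n∸m≡n i r | ℕP.[m+n]∸[m+o]≡n∸o i m r | ≡.sym (ℕP.∸-+-assoc N i r) = refl

  binomial-product-expansion : ∀ N s s′ i m K → s ℕ.+ s′ ≡ N → i ℕ.+ m < K →
    ι (s C i) * ι (s′ C m) ≈ Σ (upTo K) (λ j → expansionCoeff N i m j * ι (s C j))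
  binomial-product-expansion N s s′ i m K s+s′≡N i+m<K = sym (begin
    Σ (upTo K) f
      ≈⟨ Σ-upTo-window K i m f i+m<K
           (λ j j<i → trans (*-congʳ (expansionCoeff-below N i m j j<i)) (zeroˡ _))
           (λ j i+m<j → trans (*-congʳ (expansionCoeff-above N i m j i+m<j)) (zeroˡ _)) ⟩
    Σ (upTo (suc m)) (λ r → f (i ℕ.+ r))
      ≈⟨ Σ-upTo-cong (suc m) (λ r r<1+m → window r (ℕP.≤-pred r<1+m)) ⟩
    Σ (upTo (suc m)) (λ r → ι (s C i) * alternatingTerm (s ∸ i) (N ∸ i) m r)
      ≈⟨ *-distribˡ-Σ (upTo (suc m)) _ _ ⟨
    ι (s C i) * Σ (upTo (suc m)) (alternatingTerm (s ∸ i) (N ∸ i) m)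
      ≈⟨ inclusion-exclusion (i ℕP.≤? s) ⟩
    ι (s C i) * ι (s′ C m) ∎)
    where
    f : ℕ → Carrier
    f j = expansionCoeff N i m j * ι (s C j)
    window : ∀ r → r ≤ m → f (i ℕ.+ r) ≈ ι (s C i) * alternatingTerm (s ∸ i) (N ∸ i) m r
    window r r≤m = begin
      expansionCoeff N i m (i ℕ.+ r) * ι (s C (i ℕ.+ r))
        ≈⟨ *-congʳ (expansionCoeff-window N i m r r≤m) ⟩
      negOnePow r * ι (((i ℕ.+ r) C i) ℕ.* Y) * ι (s C (i ℕ.+ r))
        ≈⟨ trans (*-assoc _ _ _) (*-congˡ (sym (ι-* (((i ℕ.+ r) C i) ℕ.* Y) (s C (i ℕ.+ r))))) ⟩
      negOnePow r * ι (((i ℕ.+ r) C i) ℕ.* Y ℕ.* (s C (i ℕ.+ r)))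
        ≡⟨ ≡.cong (λ z → negOnePow r * ι z) revised ⟩
      negOnePow r * ι ((s C i) ℕ.* (((s ∸ i) C r) ℕ.* Y))
        ≈⟨ *-congˡ (ι-* (s C i) _) ⟩
      negOnePow r * (ι (s C i) * ι (((s ∸ i) C r) ℕ.* Y))
        ≈⟨ x∙yz≈y∙xz _ _ _ ⟩
      ι (s C i) * alternatingTerm (s ∸ i) (N ∸ i) m r ∎
      where
      open CommSemigroupProperties *-commutativeSemigroup using (x∙yz≈y∙xz)
      Y = (N ∸ i ∸ r) C (m ∸ r)
      revised : ((i ℕ.+ r) C i) ℕ.* Y ℕ.* (s C (i ℕ.+ r)) ≡ (s C i) ℕ.* (((s ∸ i) C r) ℕ.* Y)
      revised = ≡.trans (xy∙z≈xz∙y ((i ℕ.+ r) C i) Y (s C (i ℕ.+ r)))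
                  (≡.trans (≡.cong (ℕ._* Y) (trinomial-revision i r s)) (ℕP.*-assoc (s C i) ((s ∸ i) C r) Y))
        where open CommSemigroupProperties ℕP.*-commutativeSemigroup using (xy∙z≈xz∙y)
    inclusion-exclusion : Dec (i ≤ s) →
      ι (s C i) * Σ (upTo (suc m)) (alternatingTerm (s ∸ i) (N ∸ i) m) ≈ ι (s C i) * ι (s′ C m)
    inclusion-exclusion (yes i≤s) = *-congˡ (trans
      (Σ-alternatingTerm (s ∸ i) (N ∸ i) m (ℕP.∸-monoˡ-≤ i (≡.subst (s ≤_) s+s′≡N (ℕP.m≤m+n s s′))))
      (reflexive (≡.cong (λ z → ι (z C m)) N∸i∸[s∸i]≡s′)))
      where
      N∸i∸[s∸i]≡s′ : N ∸ i ∸ (s ∸ i) ≡ s′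
      N∸i∸[s∸i]≡s′ = ≡.trans (ℕP.∸-+-assoc N i (s ∸ i))
                       (≡.trans (≡.cong (N ∸_) (ℕP.m+[n∸m]≡n i≤s))
                         (≡.trans (≡.cong (_∸ s) (≡.sym s+s′≡N)) (ℕP.m+n∸m≡n s s′)))
    inclusion-exclusion (no i≰s) = trans (*-congʳ sCi≈0) (trans (zeroˡ _) (sym (trans (*-congʳ sCi≈0) (zeroˡ _))))
      where sCi≈0 = reflexive (≡.cong ι (k>n⇒nCk≡0 (ℕP.≰⇒> i≰s)))


  -- The filtration

  module Filtration (n : ℕ) (D : Subset n) (α : Subset n → Carrier) where

    d K N : ℕ
    d = ∣ D ∣
    K = suc d
    N = n ∸ d

    x : 𝒜 n
    x = ∇α D α

    avoiding : ℕ → Subset n → Carrier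
    avoiding l Z = ι (count inside outside D Z C l)

    transitionTerm : Subset n → ℕ → Subset n → ℕ → Carrier
    transitionTerm X l B j = guard (does (B ⊆? D)) (guard (does (∣ B ∣ ℕ.≟ l))
      (ι (ω′ X B) * expansionCoeff N (count inside inside X B) (count outside inside X B) j))

    transition : ℕ → ℕ → Carrier
    transition l j = Σ (sameSize D) (λ X → α X * Σ (allSubsets n) (λ B → transitionTerm X l B j))

    x-triangular : ∀ l → l < K → ∀ W → ∣ W ∣ ≡ d →
      Σ (allPerms n) (λ u → x u * avoiding l (image (flip u) W)) ≈ Σ (upTo K) (λ j → transition l j * avoiding j W)
    x-triangular l l<K W ∣W∣≡d = begin
      Σ (allPerms n) (λ u → Σ (sameSize D) (λ X → α X * ∇ D X u) * p u)
        ≈⟨ Σ-cong (allPerms n) (λ u →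
             trans (*-distribʳ-Σ (sameSize D) _ _) (Σ-cong (sameSize D) (λ X → *-assoc _ _ _))) ⟩
      Σ (allPerms n) (λ u → Σ (sameSize D) (λ X → α X * (∇ D X u * p u)))
        ≈⟨ Σ-comm (allPerms n) (sameSize D) _ ⟩
      Σ (sameSize D) (λ X → Σ (allPerms n) (λ u → α X * (∇ D X u * p u)))
        ≈⟨ Σ-cong (sameSize D) (λ X → *-distribˡ-Σ (allPerms n) (α X) _) ⟨
      Σ (sameSize D) (λ X → α X * Σ (allPerms n) (λ u → ∇ D X u * p u))
        ≈⟨ Σ-sameSize-cong D (λ X ∣X∣≡d →
             *-congˡ (trans (Σ-∇-avoiding n D X W l ∣X∣≡d) (Σ-cong (allSubsets n) (expanded X)))) ⟩
      Σ (sameSize D) (λ X → α X * Σ (allSubsets n) (λ B → Σ (upTo K) (λ j → transitionTerm X l B j * avoiding j W)))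
        ≈⟨ Σ-cong (sameSize D) (λ X →
             trans (*-congˡ (Σ-collectʳ (allSubsets n) (upTo K) (transitionTerm X l) (λ j → avoiding j W)))
                   (*-collectʳ (upTo K) (α X) _ _)) ⟩
      Σ (sameSize D) (λ X → Σ (upTo K) (λ j → (α X * Σ (allSubsets n) (λ B → transitionTerm X l B j)) * avoiding j W))
        ≈⟨ Σ-collectʳ (sameSize D) (upTo K) _ _ ⟩
      Σ (upTo K) (λ j → transition l j * avoiding j W) ∎
      where
      p : Perm n → Carrier
      p u = avoiding l (image (flip u) W)
      expanded : ∀ X B →
        guard (does (B ⊆? D)) (guard (does (∣ B ∣ ℕ.≟ l))
          (ι (ω′ X B) * (ι (count inside outside D W C count inside inside X B)
                         * ι (count outside outside D W C count outside inside X B))))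
        ≈ Σ (upTo K) (λ j → transitionTerm X l B j * avoiding j W)
      expanded X B = trans
        (guard-cong (B ⊆? D) (λ _ → trans
          (guard-cong (∣ B ∣ ℕ.≟ l) (λ ∣B∣≡l → trans
            (*-congˡ (binomial-product-expansion N (count inside outside D W) (count outside outside D W)
                        (count inside inside X B) (count outside inside X B) K (count-io+oo D W ∣W∣≡d)
                        (≡.subst (_< K) (≡.sym (≡.trans (count-ii+oi X B) ∣B∣≡l)) l<K)))
            (*-collectʳ (upTo K) (ι (ω′ X B)) _ _)))
          (guard-collectʳ (upTo K) (does (∣ B ∣ ℕ.≟ l)) _ _)))
        (guard-collectʳ (upTo K) (does (B ⊆? D)) _ _)

    transition-diagonal : ∀ l → transition l l ≈ δα D α l
    transition-diagonal l = Σ-cong (sameSize D) (λ X → *-congˡ (begin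
      Σ (allSubsets n) (λ B → transitionTerm X l B l)
        ≈⟨ Σ-cong (allSubsets n) (λ B → guard-cong (B ⊆? D) (λ _ →
             guard-cong (∣ B ∣ ℕ.≟ l) (λ ∣B∣≡l → diagonal X B l (≡.trans (count-ii+oi X B) ∣B∣≡l)))) ⟩
      Σ (allSubsets n) (λ B → guard (does (B ⊆? D)) (δ-term X B))
        ≈⟨ Σ-filter (λ B → B ⊆? D) (allSubsets n) (δ-term X) ⟨
      δ D X l ∎))
      where
      δ-term : Subset n → Subset n → Carrier
      δ-term X B =
        if does (∣ B ∣ ℕ.≟ l) then ι (ω B X ℕ.* (l C ∣ B ∩ X ∣)) * negOnePow (l ∸ ∣ B ∩ X ∣) else 0#
      diagonal : ∀ X B l → count inside inside X B ℕ.+ count outside inside X B ≡ l →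
        ι (ω′ X B) * expansionCoeff N (count inside inside X B) (count outside inside X B) l
        ≈ ι (ω B X ℕ.* (l C ∣ B ∩ X ∣)) * negOnePow (l ∸ ∣ B ∩ X ∣)
      diagonal X B l ≡.refl rewrite ω≡ω′ X B | ∣∩∣≡count X B = begin
        ι (ω′ X B) * expansionCoeff N i m (i ℕ.+ m)
          ≈⟨ *-congˡ (expansionCoeff-window N i m m ℕP.≤-refl) ⟩
        ι (ω′ X B) * (negOnePow m * ι (((i ℕ.+ m) C i) ℕ.* ((N ∸ i ∸ m) C (m ∸ m))))
          ≡⟨ ≡.cong₂ (λ r k → ι (ω′ X B) * (negOnePow r * ι (((i ℕ.+ m) C i) ℕ.* ((N ∸ i ∸ m) C k))))
                     (≡.sym (ℕP.m+n∸m≡n i m)) (ℕP.n∸n≡0 m) ⟩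
        ι (ω′ X B) * (negOnePow (i ℕ.+ m ∸ i) * ι (((i ℕ.+ m) C i) ℕ.* 1))
          ≈⟨ *-congˡ (*-comm _ _) ⟩
        ι (ω′ X B) * (ι (((i ℕ.+ m) C i) ℕ.* 1) * negOnePow (i ℕ.+ m ∸ i))
          ≈⟨ *-assoc _ _ _ ⟨
        ι (ω′ X B) * ι (((i ℕ.+ m) C i) ℕ.* 1) * negOnePow (i ℕ.+ m ∸ i)
          ≈⟨ *-congʳ (trans (sym (ι-* (ω′ X B) _))
                            (reflexive (≡.cong (λ k → ι (ω′ X B ℕ.* k)) (ℕP.*-identityʳ _)))) ⟩
        ι (ω′ X B ℕ.* ((i ℕ.+ m) C i)) * negOnePow (i ℕ.+ m ∸ i) ∎
        where
        i = count inside inside X B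
        m = count outside inside X B

    transition-above : ∀ l j → l < j → transition l j ≈ 0#
    transition-above l j l<j = Σ-≈0 (sameSize D) (λ X → trans (*-congˡ (Σ-≈0 (allSubsets n) (λ B →
      guard-≈0 (does (B ⊆? D))
        (trans (guard-cong (∣ B ∣ ℕ.≟ l) (λ ∣B∣≡l → trans (*-congˡ (beyond X B ∣B∣≡l)) (zeroʳ _)))
               (guard-0# (does (∣ B ∣ ℕ.≟ l))))))) (zeroʳ _))
      where
      beyond : ∀ X B → ∣ B ∣ ≡ l → expansionCoeff N (count inside inside X B) (count outside inside X B) j ≈ 0#
      beyond X B ∣B∣≡l = expansionCoeff-above N (count inside inside X B) (count outside inside X B) j
                           (≡.subst (_< j) (≡.sym (≡.trans (count-ii+oi X B) ∣B∣≡l)) l<j)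

    combination : (Subset n → ℕ → Carrier) → 𝒜 n
    combination a w = Σ (sameSize D) (λ X → Σ (upTo K) (λ l → a X l * avoiding l (image w X)))

    combination-congruent : ∀ a → Congruent (combination a)
    combination-congruent a u v u≈v = Σ-cong (sameSize D) (λ X → Σ-cong (upTo K) (λ l →
      reflexive (≡.cong (λ Z → a X l * avoiding l Z) (image-cong u v X u≈v))))

    x*ᴬcombination : ∀ a →
      (x *ᴬ combination a) ≈ᴬ combination (λ X j → Σ (upTo K) (λ l → a X l * transition l j))
    x*ᴬcombination a w = begin
      Σ (allPerms n) (λ u → x u * Σ (sameSize D) (λ X → Σ (upTo K) (λ l →
        a X l * avoiding l (image (flip u ·ₚ w) X))))
        ≈⟨ Σ-cong (allPerms n) (λ u → trans (*-distribˡ-Σ (sameSize D) (x u) _) (Σ-cong (sameSize D) (λ X →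
             trans (*-distribˡ-Σ (upTo K) (x u) _) (Σ-cong (upTo K) (λ l → moved u X l))))) ⟩
      Σ (allPerms n) (λ u → Σ (sameSize D) (λ X → Σ (upTo K) (λ l → a X l * (x u * p u X l))))
        ≈⟨ Σ-comm (allPerms n) (sameSize D) _ ⟩
      Σ (sameSize D) (λ X → Σ (allPerms n) (λ u → Σ (upTo K) (λ l → a X l * (x u * p u X l))))
        ≈⟨ Σ-cong (sameSize D) (λ X → trans (Σ-comm (allPerms n) (upTo K) _)
             (Σ-cong (upTo K) (λ l → sym (*-distribˡ-Σ (allPerms n) (a X l) _)))) ⟩
      Σ (sameSize D) (λ X → Σ (upTo K) (λ l → a X l * Σ (allPerms n) (λ u → x u * p u X l)))
        ≈⟨ Σ-sameSize-cong D (λ X ∣X∣≡d → Σ-upTo-cong K (λ l l<K →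
             *-congˡ (x-triangular l l<K (image w X) (≡.trans (∣image∣ w X) ∣X∣≡d)))) ⟩
      Σ (sameSize D) (λ X → Σ (upTo K) (λ l → a X l * Σ (upTo K) (λ j → transition l j * avoiding j (image w X))))
        ≈⟨ Σ-cong (sameSize D) (λ X → trans (Σ-cong (upTo K) (λ l → *-collectʳ (upTo K) (a X l) _ _))
                                            (Σ-collectʳ (upTo K) (upTo K) _ _)) ⟩
      combination (λ X j → Σ (upTo K) (λ l → a X l * transition l j)) w ∎
      where
      open CommSemigroupProperties *-commutativeSemigroup using (x∙yz≈y∙xz)
      p : Perm n → Subset n → ℕ → Carrier
      p u X l = avoiding l (image (flip u) (image w X))
      moved : ∀ u X l → x u * (a X l * avoiding l (image (flip u ·ₚ w) X)) ≈ a X l * (x u * p u X l)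
      moved u X l = trans (x∙yz≈y∙xz (x u) (a X l) _)
                          (reflexive (≡.cong (λ Z → a X l * (x u * avoiding l Z)) (image-∘ u w X)))

    scalar*ᴬcombination : ∀ s a → (scalar s *ᴬ combination a) ≈ᴬ combination (λ X j → s * a X j)
    scalar*ᴬcombination s a w = begin
      (scalar s *ᴬ combination a) w
        ≈⟨ scalar-*ᴬ s (combination a) (combination-congruent a) w ⟩
      s * combination a w
        ≈⟨ trans (*-distribˡ-Σ (sameSize D) s _) (Σ-cong (sameSize D) (λ X → *-collectʳ (upTo K) s _ _)) ⟩
      combination (λ X j → s * a X j) w ∎

    combination-− : ∀ a b w → combination a w - combination b w ≈ combination (λ X j → a X j - b X j) w
    combination-− a b w = sym (begin
      combination (λ X j → a X j - b X j) w
        ≈⟨ Σ-cong (sameSize D) (λ X → Σ-cong (upTo K) (λ l →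
             trans (distribʳ _ _ _) (+-congˡ (sym (-‿distribˡ-* _ _))))) ⟩
      Σ (sameSize D) (λ X → Σ (upTo K) (λ l → a X l * p X l - b X l * p X l))
        ≈⟨ Σ-cong (sameSize D) (λ X → Σ-distrib-- (upTo K) _ _) ⟩
      Σ (sameSize D) (λ X → Σ (upTo K) (λ l → a X l * p X l) - Σ (upTo K) (λ l → b X l * p X l))
        ≈⟨ Σ-distrib-- (sameSize D) _ _ ⟩
      combination a w - combination b w ∎)
      where
      p : Subset n → ℕ → Carrier
      p X l = avoiding l (image w X)

    record Filtered (k : ℕ) (y : 𝒜 n) : Set (c Level.⊔ ℓ) where
      field
        coeff          : Subset n → ℕ → Carrier
        coeff-vanishes : ∀ X l → k ≤ l → coeff X l ≈ 0#
        ≈combination   : y ≈ᴬ combination coeff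

    F : ℕ → 𝒜 n
    F k = x -ᴬ scalar (δα D α k)

    lower : ℕ → (Subset n → ℕ → Carrier) → Subset n → ℕ → Carrier
    lower k a X j = Σ (upTo K) (λ l → a X l * transition l j) - δα D α k * a X j

    lower-vanishes : ∀ k a → k < K → (∀ X l → k < l → a X l ≈ 0#) → ∀ X j → k ≤ j → lower k a X j ≈ 0#
    lower-vanishes k a k<K a-vanishes = vanishes
      where
      δₖ = δα D α k
      term≈0 : ∀ X l j → l < j ⊎ k < l → a X l * transition l j ≈ 0#
      term≈0 X l j (inj₁ l<j) = trans (*-congˡ (transition-above l j l<j)) (zeroʳ _)
      term≈0 X l j (inj₂ k<l) = trans (*-congʳ (a-vanishes X l k<l)) (zeroˡ _)
      apart : ∀ l → l ≢ k → l < k ⊎ k < l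
      apart l l≢k with ℕP.<-cmp l k
      ... | tri< l<k _ _ = inj₁ l<k
      ... | tri≈ _ l≡k _ = contradiction l≡k l≢k
      ... | tri> _ _ k<l = inj₂ k<l
      vanishes : ∀ X j → k ≤ j → lower k a X j ≈ 0#
      vanishes X j k≤j with ℕP.m≤n⇒m<n∨m≡n k≤j
      ... | inj₂ ≡.refl = begin
        Σ (upTo K) (λ l → a X l * transition l k) - δₖ * a X k
          ≈⟨ +-congʳ (Σ-upTo-single K k _ k<K (λ l l≢k → term≈0 X l k (apart l l≢k))) ⟩
        a X k * transition k k - δₖ * a X k
          ≈⟨ +-congʳ (trans (*-congˡ (transition-diagonal k)) (*-comm _ _)) ⟩
        δₖ * a X k - δₖ * a X k
          ≈⟨ -‿inverseʳ _ ⟩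
        0# ∎
      ... | inj₁ k<j = begin
        Σ (upTo K) (λ l → a X l * transition l j) - δₖ * a X j
          ≈⟨ +-cong (Σ-≈0 (upTo K) (λ l → term≈0 X l j (below-or-above l)))
                    (-‿cong (trans (*-congˡ (a-vanishes X j k<j)) (zeroʳ _))) ⟩
        0# - 0#
          ≈⟨ -‿inverseʳ _ ⟩
        0# ∎
        where
        below-or-above : ∀ l → l < j ⊎ k < l
        below-or-above l with l ℕP.<? j
        ... | yes l<j = inj₁ l<j
        ... | no  l≮j = inj₂ (ℕP.<-≤-trans k<j (ℕP.≮⇒≥ l≮j))

    F-lowers : ∀ k y → k < K → Filtered (suc k) y → Filtered k (F k *ᴬ y)
    F-lowers k y k<K y∈ = record
      { coeff = lower k a ; coeff-vanishes = lower-vanishes k a k<K a-vanishes ; ≈combination = y′≈ }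
      where
      open Filtered y∈ renaming (coeff to a; coeff-vanishes to a-vanishes)
      δₖ = δα D α k
      y′≈ : (F k *ᴬ y) ≈ᴬ combination (lower k a)
      y′≈ w = begin
        (F k *ᴬ y) w
          ≈⟨ *ᴬ-congʳ (F k) ≈combination w ⟩
        (F k *ᴬ combination a) w
          ≈⟨ -ᴬ-*ᴬ x (scalar δₖ) (combination a) w ⟩
        (x *ᴬ combination a) w - (scalar δₖ *ᴬ combination a) w
          ≈⟨ +-cong (x*ᴬcombination a w) (-‿cong (scalar*ᴬcombination δₖ a w)) ⟩
        _ - _
          ≈⟨ combination-− _ _ w ⟩
        combination (lower k a) w ∎

    Filtered0⇒≈0ᴬ : ∀ y → Filtered 0 y → y ≈ᴬ 0ᴬ
    Filtered0⇒≈0ᴬ y y∈ w = trans (≈combination w) (Σ-≈0 (sameSize D) (λ X → Σ-≈0 (upTo K) (λ l →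
      trans (*-congʳ (coeff-vanishes X l z≤n)) (zeroˡ _))))
      where open Filtered y∈

    x-filtered : Filtered K x
    x-filtered = record { coeff = a₀ ; coeff-vanishes = a₀-vanishes ; ≈combination = x≈ }
      where
      a₀ : Subset n → ℕ → Carrier
      a₀ X l = guard (does (l ℕ.<? K)) (α X * negOnePow l)
      a₀-vanishes : ∀ X l → K ≤ l → a₀ X l ≈ 0#
      a₀-vanishes X l K≤l rewrite dec-false (l ℕ.<? K) (ℕP.≤⇒≯ K≤l) = refl
      a₀-below : ∀ X l → l < K → a₀ X l ≡ α X * negOnePow l
      a₀-below X l l<K = ≡.cong (λ b → guard b (α X * negOnePow l)) (dec-true (l ℕ.<? K) l<K)
      expanded : ∀ X W → ∣ W ∣ ≡ d → α X * guard (subsetEq W D) 1# ≈ Σ (upTo K) (λ l → a₀ X l * avoiding l W)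
      expanded X W ∣W∣≡d = begin
        α X * guard (subsetEq W D) 1#
          ≡⟨ ≡.cong (λ b → α X * guard b 1#) (subsetEq≡count-io≟0 D W ∣W∣≡d) ⟩
        α X * guard (does (count inside outside D W ℕ.≟ 0)) 1#
          ≈⟨ *-congˡ (Σ-alternating-binomial (count inside outside D W) d
               (≡.subst (count inside outside D W ≤_) (count-ii+io D W) (ℕP.m≤n+m _ _))) ⟨
        α X * Σ (upTo K) (λ l → negOnePow l * avoiding l W)
          ≈⟨ *-distribˡ-Σ (upTo K) (α X) _ ⟩
        Σ (upTo K) (λ l → α X * (negOnePow l * avoiding l W))
          ≈⟨ Σ-upTo-cong K (λ l l<K →
               trans (sym (*-assoc _ _ _)) (*-congʳ (reflexive (≡.sym (a₀-below X l l<K))))) ⟩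
        Σ (upTo K) (λ l → a₀ X l * avoiding l W) ∎
      x≈ : x ≈ᴬ combination a₀
      x≈ w = Σ-sameSize-cong D (λ X ∣X∣≡d → expanded X (image w X) (≡.trans (∣image∣ w X) ∣X∣≡d))

    F-fold-lowers : ∀ m → m ≤ K → ∀ z → Filtered m z → Filtered 0 (foldr (λ k acc → F k *ᴬ acc) z (upTo m))
    F-fold-lowers zero    _   z z∈ = z∈
    F-fold-lowers (suc m) m<K z z∈ =
      ≡.subst (Filtered 0) unfold (F-fold-lowers m (ℕP.<⇒≤ m<K) (F m *ᴬ z) (F-lowers m z m<K z∈))
      where
      unfold : foldr (λ k acc → F k *ᴬ acc) (F m *ᴬ z) (upTo m) ≡ foldr (λ k acc → F k *ᴬ acc) z (upTo (suc m))
      unfold = ≡.trans (≡.sym (ListP.foldr-∷ʳ _ z m (upTo m)))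
                       (≡.cong (foldr _ z) (ListP.applyUpTo-∷ʳ (λ i → i) m))


theorem1p4p1 : ∀ {c ℓ : Level} (R : CommutativeRing c ℓ) →
    (n : ℕ) (D : Subset n) (α : Subset n → CommutativeRing.Carrier R) →
    GroupAlgebra._≈ᴬ_ R
      (GroupAlgebra._*ᴬ_ R
        (GroupAlgebra.∏ᴬ R (upTo (suc ∣ D ∣))
          (λ k → GroupAlgebra._-ᴬ_ R (GroupAlgebra.∇α R D α) (GroupAlgebra.scalar R (GroupAlgebra.δα R D α k))))
        (GroupAlgebra.∇α R D α))
      (GroupAlgebra.0ᴬ R)
theorem1p4p1 R n D α w = trans (∏ᴬ-*ᴬ R (upTo K) F x (∇α-congruent R D α) w)
                               (Filtered0⇒≈0ᴬ _ (F-fold-lowers K ℕP.≤-refl x x-filtered) w)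
  where
  open CommutativeRing R using (trans)
  open Filtration R n D α
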